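{- Let $m$ be an even positive integer and let $n,r$ be positive integers. There exists an $SMR(m,n;r,2)$ if and only if either $m=2$ and $n=r\equiv 0$ or $3\pmod 4$, or $m\geq 4$, $r\geq 3$ and $mr=2n$.
   Context: A signed magic rectangle $SMR(m,n;r,s)$ is an $m\times n$ array, some of whose cells are filled with integers and the others empty, such that exactly $r$ cells in every row and exactly $s$ cells in every column are filled (so $mr=ns$), every element of $X$ appears exactly once in the array, and the sum of the entries of each row and of each column is zero, where (for $mr$ even) $X=\{\pm1,\pm2,\ldots,\pm mr/2\}$. -}

module Defs where

open import Data.Nat using (ℕ; zero; suc; _+_; _*_; _≤_)
open import Data.Integer as ℤ using (ℤ; ∣_∣)
open import Data.Fin using (Fin; zero; suc)
open import Data.Maybe using (Maybe; just; nothing)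
open import Data.Product using (Σ; _×_)
open import Relation.Binary.PropositionalEquality using (_≡_)
open import Relation.Nullary using (¬_)

filledCount : ∀ {k} → (Fin k → Maybe ℤ) → ℕ
filledCount {zero}  f = 0
filledCount {suc k} f with f zero
... | just _  = suc (filledCount (λ i → f (suc i)))
... | nothing = filledCount (λ i → f (suc i))

lineSum : ∀ {k} → (Fin k → Maybe ℤ) → ℤ
lineSum {zero}  f = ℤ.0ℤ
lineSum {suc k} f with f zero
... | just x  = x ℤ.+ lineSum (λ i → f (suc i))
... | nothing = lineSum (λ i → f (suc i))

Array : ℕ → ℕ → Set
Array m n = Fin m → Fin n → Maybe ℤ

-- membership in X = {±1, …, ±(m r / 2)}  (case m r even), written as
-- x ≠ 0 and 2·|x| ≤ m·r
InX : ℕ → ℤ → Set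
InX mr x = ¬ (x ≡ ℤ.0ℤ) × 2 * ∣ x ∣ ≤ mr

record SMR (m n r s : ℕ) : Set where
  field
    array      : Array m n
    shape      : m * r ≡ n * s
    rowFilled  : ∀ i → filledCount (λ j → array i j) ≡ r
    colFilled  : ∀ j → filledCount (λ i → array i j) ≡ s
    entriesInX : ∀ i j x → array i j ≡ just x → InX (m * r) x
    allAppear  : ∀ x → InX (m * r) x → Σ (Fin m) λ i → Σ (Fin n) λ j → array i j ≡ just x
    appearOnce : ∀ i j i′ j′ x → array i j ≡ just x → array i′ j′ ≡ just x → (i ≡ i′ × j ≡ j′)
    rowSum     : ∀ i → lineSum (λ j → array i j) ≡ ℤ.0ℤ
    colSum     : ∀ j → lineSum (λ i → array i j) ≡ ℤ.0ℤ

-- Fill the array column by column: column t holds t + 1 in one row and −(t + 1) in another,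
-- so every column has two entries summing to zero and X is used exactly once; it remains to
-- choose the two rows of every column so that each row gets r entries summing to zero.
-- On m = 2k rows this is done by a core of degree 3, 5 or 6 (the last two need k ≥ 2) followed
-- by layers of blocks x y y x / y x x y, which are balanced whatever labels they receive because
-- (l + 1) + (l + 4) = (l + 2) + (l + 3). This reaches every r ≥ 3 when k ≥ 2, and every
-- r ≡ 0, 3 (mod 4) for all k.
-- Conversely, a row with a single entry contains 0; with two entries per row and per column,
-- going from 1 to the −1 in its column and on to the other entry in that row returns to 1, so
-- 1 and −1 would share a cell; and for m = 2 the columns are pairs a, −a, so the first row
-- contains one of ±1, …, ±n each and sums to zero, which makes n(n + 1)/2 even, i.e.
-- n ≡ 0, 3 (mod 4).

module Submission where

open import Defs
open import Data.Nat using (ℕ; zero; suc; _+_; _*_; _≤_; _<_; z≤n; s≤s; z<s; _≡ᵇ_; _%_; _/_)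
open import Data.Nat.Properties
open import Data.Nat.DivMod using (m≡m%n+[m/n]*n; m%n<n)
open import Data.Nat.Divisibility using (_∣_; divides; ∣m+n∣m⇒∣n; n∣m*n; ∣⇒≤)
open import Data.Nat.ListAction using (sum)
open import Data.Nat.ListAction.Properties using (sum-++)
open import Data.Nat.Tactic.RingSolver using (solve-∀)
open import Data.Integer as ℤ using (ℤ; +_; -[1+_]; ∣_∣)
import Data.Integer.Properties as ℤᵖ
import Data.Integer.Tactic.RingSolver as ℤ-Solver
open import Data.Bool using (true; false; if_then_else_)
open import Data.Fin as Fin using (Fin; toℕ; fromℕ<)
import Data.Fin.Properties as Finᵖ
open import Data.Fin.Permutation using (permutation)
open import Algebra.Properties.CommutativeMonoid.Sum +-0-commutativeMonoid
  using (sum-permute; sum-cong-≗) renaming (sum to ∑)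
open import Algebra.Properties.CommutativeSemigroup +-commutativeSemigroup using (interchange)
open import Data.List using (List; []; _∷_; _++_; length; lookup; map)
open import Data.List.Properties using (length-++)
open import Data.List.Relation.Unary.All as All using (All; []; _∷_)
import Data.List.Relation.Unary.All.Properties as All
open import Data.List.Relation.Unary.AllPairs using (AllPairs; []; _∷_)
open import Data.List.Relation.Unary.Linked using (Linked; [-]; _∷_)
open import Data.List.Relation.Unary.Linked.Properties using (Linked⇒AllPairs)
open import Data.List.Relation.Unary.Any using (here; there)
open import Data.List.Membership.Propositional using (_∈_)
open import Data.List.Membership.Propositional.Properties using (∈-lookup; ∈-++⁻)
open import Data.List.Relation.Binary.Disjoint.Propositional using (Disjoint; contractₗ; contractᵣ)
open import Data.Maybe using (Maybe; just; nothing)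
import Data.Maybe.Properties as Maybe
open import Data.Product using (Σ; ∃; _×_; _,_; proj₁; proj₂)
open import Data.Sum as Sum using (_⊎_; inj₁; inj₂; [_,_])
open import Data.Empty using (⊥; ⊥-elim)
open import Function using (_∘_)
open import Function.Bundles using (_⇔_; mk⇔)
open import Relation.Nullary using (¬_; yes; no)
open import Relation.Binary.PropositionalEquality hiding ([_])

≡ᵇ-refl : ∀ x → (x ≡ᵇ x) ≡ true
≡ᵇ-refl zero    = refl
≡ᵇ-refl (suc x) = ≡ᵇ-refl x

≡ᵇ-≢ : ∀ {x y} → x ≢ y → (x ≡ᵇ y) ≡ false
≡ᵇ-≢ {zero}  {zero}  x≢y = ⊥-elim (x≢y refl)
≡ᵇ-≢ {zero}  {suc y} _   = refl
≡ᵇ-≢ {suc x} {zero}  _   = refl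
≡ᵇ-≢ {suc x} {suc y} x≢y = ≡ᵇ-≢ (x≢y ∘ cong suc)

≡ᵇ-true : ∀ x y → (x ≡ᵇ y) ≡ true → x ≡ y
≡ᵇ-true zero    zero    _  = refl
≡ᵇ-true (suc x) (suc y) eq = cong suc (≡ᵇ-true x y eq)

filledCount-cong : ∀ {k} {f g : Fin k → Maybe ℤ} → (∀ i → f i ≡ g i) → filledCount f ≡ filledCount g
filledCount-cong {zero}          _   = refl
filledCount-cong {suc k} {f} {g} f≗g with f Fin.zero | g Fin.zero | f≗g Fin.zero
... | just _  | _ | refl = cong suc (filledCount-cong (f≗g ∘ Fin.suc))
... | nothing | _ | refl = filledCount-cong (f≗g ∘ Fin.suc)

lineSum-cong : ∀ {k} {f g : Fin k → Maybe ℤ} → (∀ i → f i ≡ g i) → lineSum f ≡ lineSum g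
lineSum-cong {zero}          _   = refl
lineSum-cong {suc k} {f} {g} f≗g with f Fin.zero | g Fin.zero | f≗g Fin.zero
... | just v  | _ | refl = cong (ℤ._+_ v) (lineSum-cong (f≗g ∘ Fin.suc))
... | nothing | _ | refl = lineSum-cong (f≗g ∘ Fin.suc)

single : ℕ → ℤ → ℕ → Maybe ℤ
single q v x = if x ≡ᵇ q then just v else nothing

cell : ℕ → ℕ → ℕ → ℕ → Maybe ℤ
cell p q l x = if x ≡ᵇ p then just (+ l) else single q (ℤ.- + l) x

empty-filledCount : ∀ m → filledCount {m} (λ _ → nothing) ≡ 0
empty-filledCount zero    = refl
empty-filledCount (suc m) = empty-filledCount m

empty-lineSum : ∀ m → lineSum {m} (λ _ → nothing) ≡ ℤ.0ℤ
empty-lineSum zero    = refl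
empty-lineSum (suc m) = empty-lineSum m

single-filledCount : ∀ {m} q v → q < m → filledCount {m} (λ i → single q v (toℕ i)) ≡ 1
single-filledCount {suc m} zero    v _         = cong suc (empty-filledCount m)
single-filledCount {suc m} (suc q) v (s≤s q<m) = single-filledCount q v q<m

single-lineSum : ∀ {m} q v → q < m → lineSum {m} (λ i → single q v (toℕ i)) ≡ v
single-lineSum {suc m} zero    v _         = trans (cong (ℤ._+_ v) (empty-lineSum m)) (ℤᵖ.+-identityʳ v)
single-lineSum {suc m} (suc q) v (s≤s q<m) = single-lineSum q v q<m

column-filledCount : ∀ {m} p q l → p ≢ q → p < m → q < m → filledCount {m} (λ i → cell p q l (toℕ i)) ≡ 2
column-filledCount zero    zero    l p≢q _ _ = ⊥-elim (p≢q refl)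
column-filledCount zero    (suc q) l _ _ (s≤s q<m) = cong suc (single-filledCount q _ q<m)
column-filledCount (suc p) zero    l _ (s≤s p<m) _ = cong suc (single-filledCount p _ p<m)
column-filledCount (suc p) (suc q) l p≢q (s≤s p<m) (s≤s q<m) = column-filledCount p q l (p≢q ∘ cong suc) p<m q<m

column-lineSum : ∀ {m} p q l → p ≢ q → p < m → q < m → lineSum {m} (λ i → cell p q l (toℕ i)) ≡ ℤ.0ℤ
column-lineSum zero    zero    l p≢q _ _ = ⊥-elim (p≢q refl)
column-lineSum zero    (suc q) l _ _ (s≤s q<m) =
  trans (cong (ℤ._+_ (+ l)) (single-lineSum q _ q<m)) (ℤᵖ.+-inverseʳ (+ l))
column-lineSum (suc p) zero    l _ (s≤s p<m) _ =
  trans (cong (ℤ._+_ (ℤ.- + l)) (single-lineSum p _ p<m)) (ℤᵖ.+-inverseˡ (+ l))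
column-lineSum (suc p) (suc q) l p≢q (s≤s p<m) (s≤s q<m) = column-lineSum p q l (p≢q ∘ cong suc) p<m q<m

cell-just : ∀ p q l x {v} → cell p q l x ≡ just v → (x ≡ p × v ≡ + l) ⊎ (x ≡ q × v ≡ ℤ.- + l)
cell-just p q l x eq with x ≡ᵇ p in x≡ᵇp
... | true = inj₁ (≡ᵇ-true x p x≡ᵇp , sym (Maybe.just-injective eq))
... | false with x ≡ᵇ q in x≡ᵇq
...   | true = inj₂ (≡ᵇ-true x q x≡ᵇq , sym (Maybe.just-injective eq))
...   | false with () ← eq

-- If xs lists the rows of the columns labelled L + 1, L + 2, …, then labelsIn L ρ xs lists the
-- labels lying in row ρ.
labelsIn : ℕ → ℕ → List ℕ → List ℕ
labelsIn L ρ []       = []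
labelsIn L ρ (x ∷ xs) = if ρ ≡ᵇ x then suc L ∷ labelsIn (suc L) ρ xs else labelsIn (suc L) ρ xs

rowEntry : ℕ → ℕ → List ℕ → List ℕ → ℕ → Maybe ℤ
rowEntry L ρ (x ∷ xs) (y ∷ ys) zero    = cell x y (suc L) ρ
rowEntry L ρ (x ∷ xs) (y ∷ ys) (suc t) = rowEntry (suc L) ρ xs ys t
rowEntry _ _ _        _        _       = nothing

row-filledCount : ∀ L ρ (xs ys : List ℕ) → length xs ≡ length ys →
  Disjoint (labelsIn L ρ xs) (labelsIn L ρ ys) →
  filledCount {length xs} (λ j → rowEntry L ρ xs ys (toℕ j))
    ≡ length (labelsIn L ρ xs) + length (labelsIn L ρ ys)
row-filledCount L ρ []       []       _   _ = refl
row-filledCount L ρ (x ∷ xs) (y ∷ ys) len disj with ρ ≡ᵇ x | ρ ≡ᵇ y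
... | true  | true  = ⊥-elim (disj (here refl , here refl))
... | true  | false = cong suc (row-filledCount (suc L) ρ xs ys (suc-injective len) (contractₗ disj))
... | false | true  = trans (cong suc (row-filledCount (suc L) ρ xs ys (suc-injective len) (contractᵣ disj)))
                            (sym (+-suc _ _))
... | false | false = row-filledCount (suc L) ρ xs ys (suc-injective len) disj

-l+[a-b]≡a-[l+b] : ∀ l a b → ℤ.- l ℤ.+ (a ℤ.- b) ≡ a ℤ.- (l ℤ.+ b)
-l+[a-b]≡a-[l+b] = ℤ-Solver.solve-∀

row-lineSum : ∀ L ρ (xs ys : List ℕ) → length xs ≡ length ys →
  Disjoint (labelsIn L ρ xs) (labelsIn L ρ ys) →
  lineSum {length xs} (λ j → rowEntry L ρ xs ys (toℕ j))
    ≡ + sum (labelsIn L ρ xs) ℤ.- + sum (labelsIn L ρ ys)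
row-lineSum L ρ []       []       _   _ = refl
row-lineSum L ρ (x ∷ xs) (y ∷ ys) len disj with ρ ≡ᵇ x | ρ ≡ᵇ y
... | true  | true  = ⊥-elim (disj (here refl , here refl))
... | true  | false = trans (cong (ℤ._+_ (+ suc L)) (row-lineSum (suc L) ρ xs ys (suc-injective len) (contractₗ disj)))
  (trans (sym (ℤᵖ.+-assoc (+ suc L) (+ a) (ℤ.- + b))) (cong (λ w → w ℤ.- + b) (sym (ℤᵖ.pos-+ (suc L) a))))
  where a = sum (labelsIn (suc L) ρ xs)
        b = sum (labelsIn (suc L) ρ ys)
... | false | true  = trans (cong (ℤ._+_ (ℤ.- + suc L)) (row-lineSum (suc L) ρ xs ys (suc-injective len) (contractᵣ disj)))
  (trans (-l+[a-b]≡a-[l+b] (+ suc L) (+ a) (+ b)) (cong (λ w → + a ℤ.- w) (sym (ℤᵖ.pos-+ (suc L) b))))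
  where a = sum (labelsIn (suc L) ρ xs)
        b = sum (labelsIn (suc L) ρ ys)
... | false | false = row-lineSum (suc L) ρ xs ys (suc-injective len) disj

rowEntry-lookup : ∀ L ρ (xs ys : List ℕ) (len : length xs ≡ length ys) (j : Fin (length xs)) →
  rowEntry L ρ xs ys (toℕ j) ≡ cell (lookup xs j) (lookup ys (Fin.cast len j)) (L + suc (toℕ j)) ρ
rowEntry-lookup L ρ (x ∷ xs) (y ∷ ys) len Fin.zero    = cong (λ l → cell x y l ρ) (+-comm 1 L)
rowEntry-lookup L ρ (x ∷ xs) (y ∷ ys) len (Fin.suc j) =
  trans (rowEntry-lookup (suc L) ρ xs ys (suc-injective len) j)
        (cong (λ l → cell (lookup xs j) (lookup ys (Fin.cast (suc-injective len) j)) l ρ) (sym (+-suc L (suc (toℕ j)))))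

∈-if : ∀ {a c : ℕ} {ys} b → a ∈ ys → a ∈ (if b then c ∷ ys else ys)
∈-if true  a∈ys = there a∈ys
∈-if false a∈ys = a∈ys

lookup∈labelsIn : ∀ L (xs : List ℕ) (j : Fin (length xs)) → L + suc (toℕ j) ∈ labelsIn L (lookup xs j) xs
lookup∈labelsIn L (x ∷ xs) Fin.zero rewrite ≡ᵇ-refl x = here (+-comm L 1)
lookup∈labelsIn L (x ∷ xs) (Fin.suc j) = ∈-if (lookup xs j ≡ᵇ x)
  (subst (_∈ labelsIn (suc L) (lookup xs j) xs) (sym (+-suc L (suc (toℕ j)))) (lookup∈labelsIn (suc L) xs j))

record Balanced (L ρ : ℕ) (xs ys : List ℕ) (c : ℕ) : Set where
  field
    disjoint : Disjoint (labelsIn L ρ xs) (labelsIn L ρ ys)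
    sums     : sum (labelsIn L ρ xs) ≡ sum (labelsIn L ρ ys)
    count    : length (labelsIn L ρ xs) + length (labelsIn L ρ ys) ≡ c

-- Column t carries t + 1 in row pos[t] and −(t + 1) in row neg[t].
record Design (m r : ℕ) : Set where
  field
    pos neg    : List ℕ
    sameLength : length pos ≡ length neg
    posInRange : All (_< m) pos
    negInRange : All (_< m) neg
    width      : length pos * 2 ≡ m * r
    balanced   : ∀ ρ → ρ < m → Balanced 0 ρ pos neg r

label-injective : ∀ {n} {j j′ : Fin n} → suc (toℕ j) ≡ suc (toℕ j′) → j ≡ j′
label-injective = Finᵖ.toℕ-injective ∘ suc-injective

module _ {m r : ℕ} (D : Design m r) where
  open Design D

  private
    n : ℕ
    n = length pos

    P N : Fin n → ℕ
    P j = lookup pos j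
    N j = lookup neg (Fin.cast sameLength j)

    P<m : ∀ j → P j < m
    P<m j = All.lookup posInRange (∈-lookup j)

    N<m : ∀ j → N j < m
    N<m j = All.lookup negInRange (∈-lookup (Fin.cast sameLength j))

    array : Array m n
    array i j = cell (P j) (N j) (suc (toℕ j)) (toℕ i)

    P≢N : ∀ j → P j ≢ N j
    P≢N j P≡N = Balanced.disjoint (balanced (P j) (P<m j))
      ( lookup∈labelsIn 0 pos j
      , subst₂ (λ l ρ → l ∈ labelsIn 0 ρ neg) (cong suc (Finᵖ.toℕ-cast sameLength j)) (sym P≡N)
          (lookup∈labelsIn 0 neg (Fin.cast sameLength j)))

    row≗rowEntry : ∀ i j → array i j ≡ rowEntry 0 (toℕ i) pos neg (toℕ j)
    row≗rowEntry i j = sym (rowEntry-lookup 0 (toℕ i) pos neg sameLength j)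

    label-bound : ∀ (j : Fin n) → 2 * suc (toℕ j) ≤ m * r
    label-bound j = subst (2 * suc (toℕ j) ≤_) (trans (*-comm 2 n) width) (*-monoʳ-≤ 2 (Finᵖ.toℕ<n j))

    index-bound : ∀ a → 2 * suc a ≤ m * r → a < n
    index-bound a h = *-cancelˡ-≤ 2 (subst (2 * suc a ≤_) (trans (sym width) (*-comm n 2)) h)

    entriesInX : ∀ i j x → array i j ≡ just x → InX (m * r) x
    entriesInX i j x eq with cell-just (P j) (N j) (suc (toℕ j)) (toℕ i) eq
    ... | inj₁ (_ , refl) = (λ ()) , label-bound j
    ... | inj₂ (_ , refl) = (λ ()) , label-bound j

    allAppear : ∀ x → InX (m * r) x → Σ (Fin m) λ i → Σ (Fin n) λ j → array i j ≡ just x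
    allAppear (+ zero)   (x≢0 , _) = ⊥-elim (x≢0 refl)
    allAppear (+ suc a)  (_ , 2x≤mr) = fromℕ< (P<m j) , j , eq
      where
        a<n = index-bound a 2x≤mr
        j = fromℕ< a<n
        eq : array (fromℕ< (P<m j)) j ≡ just (+ suc a)
        eq rewrite Finᵖ.toℕ-fromℕ< (P<m j) | ≡ᵇ-refl (P j) | Finᵖ.toℕ-fromℕ< a<n = refl
    allAppear -[1+ a ] (_ , 2x≤mr) = fromℕ< (N<m j) , j , eq
      where
        a<n = index-bound a 2x≤mr
        j = fromℕ< a<n
        eq : array (fromℕ< (N<m j)) j ≡ just -[1+ a ]
        eq rewrite Finᵖ.toℕ-fromℕ< (N<m j) | ≡ᵇ-≢ (P≢N j ∘ sym) | ≡ᵇ-refl (N j) | Finᵖ.toℕ-fromℕ< a<n = refl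

    appearOnce : ∀ i j i′ j′ x → array i j ≡ just x → array i′ j′ ≡ just x → i ≡ i′ × j ≡ j′
    appearOnce i j i′ j′ x eq eq′
      with cell-just (P j) (N j) (suc (toℕ j)) (toℕ i) eq | cell-just (P j′) (N j′) (suc (toℕ j′)) (toℕ i′) eq′
    ... | inj₁ (i≡P , refl) | inj₁ (i′≡P , l≡l′) with refl ← label-injective (ℤᵖ.+-injective l≡l′) =
      Finᵖ.toℕ-injective (trans i≡P (sym i′≡P)) , refl
    ... | inj₂ (i≡N , refl) | inj₂ (i′≡N , l≡l′) with refl ← label-injective (cong suc (ℤᵖ.-[1+-injective l≡l′)) =
      Finᵖ.toℕ-injective (trans i≡N (sym i′≡N)) , refl
    ... | inj₁ (_ , refl) | inj₂ (_ , ())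
    ... | inj₂ (_ , refl) | inj₁ (_ , ())

    negSum : Fin m → ℕ
    negSum i = sum (labelsIn 0 (toℕ i) neg)

  design⇒SMR : SMR m n r 2
  design⇒SMR = record
    { array      = array
    ; shape      = sym width
    ; rowFilled  = λ i → let B = balanced (toℕ i) (Finᵖ.toℕ<n i) in
        trans (filledCount-cong (row≗rowEntry i))
              (trans (row-filledCount 0 (toℕ i) pos neg sameLength (Balanced.disjoint B)) (Balanced.count B))
    ; colFilled  = λ j → column-filledCount (P j) (N j) _ (P≢N j) (P<m j) (N<m j)
    ; entriesInX = entriesInX
    ; allAppear  = allAppear
    ; appearOnce = appearOnce
    ; rowSum     = λ i → let B = balanced (toℕ i) (Finᵖ.toℕ<n i) in
        trans (lineSum-cong (row≗rowEntry i))
              (trans (row-lineSum 0 (toℕ i) pos neg sameLength (Balanced.disjoint B))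
                     (trans (cong (λ s → + s ℤ.- + negSum i) (Balanced.sums B)) (ℤᵖ.+-inverseʳ (+ negSum i))))
    ; colSum     = λ j → column-lineSum (P j) (N j) _ (P≢N j) (P<m j) (N<m j)
    }

labelsIn-++ : ∀ L ρ (xs ys : List ℕ) → labelsIn L ρ (xs ++ ys) ≡ labelsIn L ρ xs ++ labelsIn (L + length xs) ρ ys
labelsIn-++ L ρ []       ys rewrite +-identityʳ L = refl
labelsIn-++ L ρ (x ∷ xs) ys rewrite +-suc L (length xs) with ρ ≡ᵇ x
... | true  = cong (suc L ∷_) (labelsIn-++ (suc L) ρ xs ys)
... | false = labelsIn-++ (suc L) ρ xs ys

labelsIn-++³ : ∀ L ρ (xs ys zs : List ℕ) → labelsIn L ρ (xs ++ ys ++ zs)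
  ≡ labelsIn L ρ xs ++ labelsIn (L + length xs) ρ ys ++ labelsIn (L + length xs + length ys) ρ zs
labelsIn-++³ L ρ xs ys zs
  rewrite labelsIn-++ L ρ xs (ys ++ zs) | labelsIn-++ (L + length xs) ρ ys zs = refl

labelsIn-++⁴ : ∀ L ρ (ws xs ys zs : List ℕ) → labelsIn L ρ (ws ++ xs ++ ys ++ zs)
  ≡ labelsIn L ρ ws ++ labelsIn (L + length ws) ρ xs ++ labelsIn (L + length ws + length xs) ρ ys
      ++ labelsIn (L + length ws + length xs + length ys) ρ zs
labelsIn-++⁴ L ρ ws xs ys zs
  rewrite labelsIn-++ L ρ ws (xs ++ ys ++ zs) | labelsIn-++³ (L + length ws) ρ xs ys zs = refl

labelsIn-absent : ∀ L ρ {xs} → All (ρ ≢_) xs → labelsIn L ρ xs ≡ []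
labelsIn-absent L ρ []                         = refl
labelsIn-absent L ρ {x ∷ _} (ρ≢x ∷ ρ∉xs) rewrite ≡ᵇ-≢ ρ≢x = labelsIn-absent (suc L) ρ ρ∉xs

private
  widen : ∀ {L n a} → suc L < a × a ≤ suc L + n → L < a × a ≤ L + suc n
  widen {L} {n} {a} (L<a , a≤) = <-trans (n<1+n L) L<a , subst (a ≤_) (sym (+-suc L n)) a≤

labelsIn-bounds : ∀ L ρ (xs : List ℕ) {a} → a ∈ labelsIn L ρ xs → L < a × a ≤ L + length xs
labelsIn-bounds L ρ (x ∷ xs) a∈ with ρ ≡ᵇ x | a∈
... | true  | here refl = ≤-refl , subst (suc L ≤_) (sym (+-suc L (length xs))) (s≤s (m≤m+n L _))
... | true  | there a∈′ = widen (labelsIn-bounds (suc L) ρ xs a∈′)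
... | false | a∈′       = widen (labelsIn-bounds (suc L) ρ xs a∈′)

Balanced-via : ∀ {L ρ xs ys} {A B : List ℕ} → labelsIn L ρ xs ≡ A → labelsIn L ρ ys ≡ B →
  Disjoint A B → sum A ≡ sum B → Balanced L ρ xs ys (length A + length B)
Balanced-via refl refl A#B ΣA≡ΣB = record { disjoint = A#B ; sums = ΣA≡ΣB ; count = refl }

Balanced-absent : ∀ {L ρ xs ys} → All (ρ ≢_) xs → All (ρ ≢_) ys → Balanced L ρ xs ys 0
Balanced-absent ρ∉xs ρ∉ys =
  Balanced-via (labelsIn-absent _ _ ρ∉xs) (labelsIn-absent _ _ ρ∉ys) (λ { (() , _) }) refl

Balanced-++ : ∀ {L ρ xs ys xs′ ys′ c c′} → length xs ≡ length ys →
  Balanced L ρ xs ys c → Balanced (L + length xs) ρ xs′ ys′ c′ →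
  Balanced L ρ (xs ++ xs′) (ys ++ ys′) (c + c′)
Balanced-++ {L} {ρ} {xs} {ys} {xs′} {ys′} {c} {c′} len B B′ =
  subst (Balanced L ρ (xs ++ xs′) (ys ++ ys′)) count
    (Balanced-via (labelsIn-++ L ρ xs xs′) labels-ys disjoint sums)
  where
    A  = labelsIn L ρ xs
    A′ = labelsIn (L + length xs) ρ xs′
    C  = labelsIn L ρ ys
    C′ = labelsIn (L + length xs) ρ ys′

    labels-ys : labelsIn L ρ (ys ++ ys′) ≡ C ++ C′
    labels-ys = trans (labelsIn-++ L ρ ys ys′) (cong (λ k → C ++ labelsIn (L + k) ρ ys′) (sym len))

    disjoint : Disjoint (A ++ A′) (C ++ C′)
    disjoint {a} (a∈ , a∈′) with ∈-++⁻ A a∈ | ∈-++⁻ C a∈′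
    ... | inj₁ a∈A  | inj₁ a∈C  = Balanced.disjoint B (a∈A , a∈C)
    ... | inj₂ a∈A′ | inj₂ a∈C′ = Balanced.disjoint B′ (a∈A′ , a∈C′)
    ... | inj₁ a∈A  | inj₂ a∈C′ = <-irrefl refl (≤-<-trans (proj₂ (labelsIn-bounds L ρ xs a∈A))
                                                          (proj₁ (labelsIn-bounds _ ρ ys′ a∈C′)))
    ... | inj₂ a∈A′ | inj₁ a∈C  = <-irrefl refl (≤-<-trans (subst (λ k → a ≤ L + k) (sym len)
                                                             (proj₂ (labelsIn-bounds L ρ ys a∈C)))
                                                          (proj₁ (labelsIn-bounds _ ρ xs′ a∈A′)))

    sums : sum (A ++ A′) ≡ sum (C ++ C′)
    sums = trans (sum-++ A A′) (trans (cong₂ _+_ (Balanced.sums B) (Balanced.sums B′)) (sym (sum-++ C C′)))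

    count : length (A ++ A′) + length (C ++ C′) ≡ c + c′
    count = begin
      length (A ++ A′) + length (C ++ C′)             ≡⟨ cong₂ _+_ (length-++ A) (length-++ C) ⟩
      (length A + length A′) + (length C + length C′) ≡⟨ interchange (length A) (length A′) (length C) (length C′) ⟩
      (length A + length C) + (length A′ + length C′) ≡⟨ cong₂ _+_ (Balanced.count B) (Balanced.count B′) ⟩
      c + c′                                          ∎
      where open ≡-Reasoning

data Entry : Set where
  ⊕_ ⊖_ : ℕ → Entry

label : Entry → ℕ
label (⊕ l) = l
label (⊖ l) = l

plus minus : List Entry → List ℕ
plus []           = []
plus (⊕ l ∷ S)    = l ∷ plus S
plus (⊖ _ ∷ S)    = plus S
minus []          = []
minus (⊕ _ ∷ S)   = minus S
minus (⊖ l ∷ S)   = l ∷ minus S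

plus⊆ : ∀ S {a} → a ∈ plus S → a ∈ map label S
plus⊆ (⊕ l ∷ S) (here refl) = here refl
plus⊆ (⊕ l ∷ S) (there a∈)  = there (plus⊆ S a∈)
plus⊆ (⊖ l ∷ S) a∈          = there (plus⊆ S a∈)

minus⊆ : ∀ S {a} → a ∈ minus S → a ∈ map label S
minus⊆ (⊖ l ∷ S) (here refl) = here refl
minus⊆ (⊖ l ∷ S) (there a∈)  = there (minus⊆ S a∈)
minus⊆ (⊕ l ∷ S) a∈          = there (minus⊆ S a∈)

increasing⇒disjoint : ∀ S → AllPairs _<_ (map label S) → Disjoint (plus S) (minus S)
increasing⇒disjoint (⊕ l ∷ S) (l< ∷ inc) (here refl , l∈) = <-irrefl refl (All.lookup l< (minus⊆ S l∈))
increasing⇒disjoint (⊕ l ∷ S) (_  ∷ inc) (there a∈ , a∈′) = increasing⇒disjoint S inc (a∈ , a∈′)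
increasing⇒disjoint (⊖ l ∷ S) (l< ∷ inc) (l∈ , here refl) = <-irrefl refl (All.lookup l< (plus⊆ S l∈))
increasing⇒disjoint (⊖ l ∷ S) (_  ∷ inc) (a∈ , there a∈′) = increasing⇒disjoint S inc (a∈ , a∈′)

plus+minus : ∀ S → length (plus S) + length (minus S) ≡ length S
plus+minus []        = refl
plus+minus (⊕ _ ∷ S) = cong suc (plus+minus S)
plus+minus (⊖ _ ∷ S) = trans (+-suc _ _) (cong suc (plus+minus S))

Balanced-chain : ∀ {L ρ xs ys} (S : List Entry) → labelsIn L ρ xs ≡ plus S → labelsIn L ρ ys ≡ minus S →
  Linked _<_ (map label S) → sum (plus S) ≡ sum (minus S) → Balanced L ρ xs ys (length S)
Balanced-chain S xs≡ ys≡ inc Σ≡ = subst (Balanced _ _ _ _) (plus+minus S)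
  (Balanced-via xs≡ ys≡ (increasing⇒disjoint S (Linked⇒AllPairs <-trans inc)) Σ≡)

Balanced-swap : ∀ {L ρ xs ys c} → Balanced L ρ xs ys c → Balanced L ρ ys xs c
Balanced-swap {L} {ρ} {xs} {ys} B = record
  { disjoint = λ (a∈ , a∈′) → Balanced.disjoint B (a∈′ , a∈)
  ; sums     = sym (Balanced.sums B)
  ; count    = trans (+-comm (length (labelsIn L ρ ys)) _) (Balanced.count B)
  }

Within : ℕ → ℕ → ℕ → Set
Within o b x = o ≤ x × x < o + b

Outside : ℕ → ℕ → ℕ → Set
Outside o b ρ = ρ < o ⊎ o + b ≤ ρ

Within₂ : ℕ → ℕ → ℕ → ℕ → Set
Within₂ o₁ o₂ b x = Within o₁ b x ⊎ Within o₂ b x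

within-bound : ∀ {o b M x} → o + b ≤ M → Within o b x → x < M
within-bound o+b≤M (_ , x<o+b) = <-≤-trans x<o+b o+b≤M

within₂-bound : ∀ {o₁ o₂ b M x} → o₁ + b ≤ M → o₂ + b ≤ M → Within₂ o₁ o₂ b x → x < M
within₂-bound h₁ h₂ = [ within-bound h₁ , within-bound h₂ ]

outside⇒≢ : ∀ {o b ρ x} → Outside o b ρ → Within o b x → ρ ≢ x
outside⇒≢ (inj₁ ρ<o)  (o≤x , _)  refl = <⇒≱ ρ<o o≤x
outside⇒≢ (inj₂ o+b≤ρ) (_ , x<o+b) refl = <⇒≱ x<o+b o+b≤ρ

outside⇒absent : ∀ {o b ρ xs} → Outside o b ρ → All (Within o b) xs → All (ρ ≢_) xs
outside⇒absent out = All.map (outside⇒≢ out)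

outside₂⇒absent : ∀ {o₁ o₂ b ρ xs} → Outside o₁ b ρ → Outside o₂ b ρ → All (Within₂ o₁ o₂ b) xs → All (ρ ≢_) xs
outside₂⇒absent out₁ out₂ = All.map [ outside⇒≢ out₁ , outside⇒≢ out₂ ]

outside-head : ∀ {o b ρ} → Outside o (suc b) ρ → ρ ≢ o
outside-head out = outside⇒≢ out (≤-refl , m<m+n _ z<s)

outside-tail : ∀ {o b ρ} → Outside o (suc b) ρ → Outside (suc o) b ρ
outside-tail             (inj₁ ρ<o)   = inj₁ (m<n⇒m<1+n ρ<o)
outside-tail {o} {b} {ρ} (inj₂ o+b<ρ) = inj₂ (subst (_≤ ρ) (+-suc o b) o+b<ρ)

within-head : ∀ o b → Within o (suc b) o
within-head o b = ≤-refl , m<m+n o (s≤s z≤n)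

within-tail : ∀ {o b x} → Within (suc o) b x → Within o (suc b) x
within-tail {o} {b} {x} (o<x , x<) = <⇒≤ o<x , subst (x <_) (sym (+-suc o b)) x<

within-init : ∀ {o b x} → Within o b x → Within o (suc b) x
within-init {o} {b} {x} (o≤x , x<) = o≤x , subst (x <_) (sym (+-suc o b)) (m<n⇒m<1+n x<)

ascending : ℕ → ℕ → List ℕ
ascending o zero    = []
ascending o (suc b) = o ∷ ascending (suc o) b

descending : ℕ → ℕ → List ℕ
descending o zero    = []
descending o (suc b) = o + b ∷ descending o b

rotated : ℕ → ℕ → List ℕ
rotated o zero    = []
rotated o (suc b) = o + b ∷ ascending o b

alternating : ℕ → ℕ → ℕ → List ℕ
alternating o₁ o₂ zero    = []
alternating o₁ o₂ (suc b) = o₁ ∷ o₂ ∷ alternating (suc o₁) (suc o₂) b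

length-ascending : ∀ o b → length (ascending o b) ≡ b
length-ascending o zero    = refl
length-ascending o (suc b) = cong suc (length-ascending (suc o) b)

length-descending : ∀ o b → length (descending o b) ≡ b
length-descending o zero    = refl
length-descending o (suc b) = cong suc (length-descending o b)

length-rotated : ∀ o b → length (rotated o b) ≡ b
length-rotated o zero    = refl
length-rotated o (suc b) = cong suc (length-ascending o b)

length-alternating : ∀ o₁ o₂ b → length (alternating o₁ o₂ b) ≡ b + b
length-alternating o₁ o₂ zero    = refl
length-alternating o₁ o₂ (suc b) =
  cong suc (trans (cong suc (length-alternating (suc o₁) (suc o₂) b)) (sym (+-suc b b)))

ascending-within : ∀ o b → All (Within o b) (ascending o b)
ascending-within o zero    = []
ascending-within o (suc b) = within-head o b ∷ All.map within-tail (ascending-within (suc o) b)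

descending-within : ∀ o b → All (Within o b) (descending o b)
descending-within o zero    = []
descending-within o (suc b) =
  (m≤m+n o b , subst (o + b <_) (sym (+-suc o b)) ≤-refl) ∷ All.map within-init (descending-within o b)

rotated-within : ∀ o b → All (Within o b) (rotated o b)
rotated-within o zero    = []
rotated-within o (suc b) =
  (m≤m+n o b , subst (o + b <_) (sym (+-suc o b)) ≤-refl) ∷ All.map within-init (ascending-within o b)

alternating-within : ∀ o₁ o₂ b → All (Within₂ o₁ o₂ b) (alternating o₁ o₂ b)
alternating-within o₁ o₂ zero    = []
alternating-within o₁ o₂ (suc b) = inj₁ (within-head o₁ b) ∷ inj₂ (within-head o₂ b)
  ∷ All.map (Sum.map within-tail within-tail) (alternating-within (suc o₁) (suc o₂) b)

ascending-absent : ∀ L ρ o b → Outside o b ρ → labelsIn L ρ (ascending o b) ≡ []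
ascending-absent L ρ o b out = labelsIn-absent L ρ (outside⇒absent out (ascending-within o b))

ascending-hit : ∀ L o b d → d < b → labelsIn L (o + d) (ascending o b) ≡ L + suc d ∷ []
ascending-hit L o (suc b) zero _ rewrite +-identityʳ o | ≡ᵇ-refl o =
  cong₂ _∷_ (+-comm 1 L) (ascending-absent (suc L) o (suc o) b (inj₁ ≤-refl))
ascending-hit L o (suc b) (suc d) (s≤s d<b) rewrite ≡ᵇ-≢ (m+1+n≢m o {d}) | +-suc o d =
  trans (ascending-hit (suc L) (suc o) b d d<b) (cong (_∷ []) (sym (+-suc L (suc d))))

descending-hit : ∀ L o b d e → suc (e + d) ≡ b → labelsIn L (o + d) (descending o b) ≡ L + suc e ∷ []
descending-hit L o _ d zero refl rewrite ≡ᵇ-refl (o + d) =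
  cong₂ _∷_ (+-comm 1 L) (labelsIn-absent (suc L) (o + d) (outside⇒absent (inj₂ ≤-refl) (descending-within o d)))
descending-hit L o _ d (suc e) refl rewrite ≡ᵇ-≢ (<⇒≢ (+-monoʳ-< o (s≤s (m≤n+m d e)))) =
  trans (descending-hit (suc L) o _ d e refl) (cong (_∷ []) (sym (+-suc L (suc e))))

rotated-last : ∀ L o b d → suc d ≡ b → labelsIn L (o + d) (rotated o b) ≡ L + 1 ∷ []
rotated-last L o _ d refl rewrite ≡ᵇ-refl (o + d) =
  cong₂ _∷_ (+-comm 1 L) (ascending-absent (suc L) (o + d) o d (inj₂ ≤-refl))

rotated-mid : ∀ L o b d → suc d < b → labelsIn L (o + d) (rotated o b) ≡ L + suc (suc d) ∷ []
rotated-mid L o (suc b) d (s≤s d<b) rewrite ≡ᵇ-≢ (<⇒≢ (+-monoʳ-< o d<b)) =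
  trans (ascending-hit (suc L) o b d d<b) (cong (_∷ []) (sym (+-suc L (suc d))))

rotated-absent : ∀ L ρ o b → Outside o b ρ → labelsIn L ρ (rotated o b) ≡ []
rotated-absent L ρ o b out = labelsIn-absent L ρ (outside⇒absent out (rotated-within o b))

descending-absent : ∀ L ρ o b → Outside o b ρ → labelsIn L ρ (descending o b) ≡ []
descending-absent L ρ o b out = labelsIn-absent L ρ (outside⇒absent out (descending-within o b))

alternating-absent : ∀ L ρ o₁ o₂ b → Outside o₁ b ρ → Outside o₂ b ρ → labelsIn L ρ (alternating o₁ o₂ b) ≡ []
alternating-absent L ρ o₁ o₂ b out₁ out₂ =
  labelsIn-absent L ρ (outside₂⇒absent out₁ out₂ (alternating-within o₁ o₂ b))

private
  two-steps : ∀ L d → suc (suc L) + suc (d + d) ≡ L + suc (suc d + suc d)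
  two-steps = solve-∀

  two-steps′ : ∀ L d → suc (suc L) + suc (suc (d + d)) ≡ L + suc (suc (suc d + suc d))
  two-steps′ = solve-∀

alternating-first : ∀ L o₁ o₂ b d → d < b → Outside o₂ b (o₁ + d) →
  labelsIn L (o₁ + d) (alternating o₁ o₂ b) ≡ L + suc (d + d) ∷ []
alternating-first L o₁ o₂ (suc b) zero _ out
  rewrite +-identityʳ o₁ | ≡ᵇ-refl o₁ | ≡ᵇ-≢ (outside-head out) =
  cong₂ _∷_ (+-comm 1 L) (alternating-absent (suc (suc L)) o₁ (suc o₁) (suc o₂) b (inj₁ ≤-refl) (outside-tail out))
alternating-first L o₁ o₂ (suc b) (suc d) (s≤s d<b) out
  rewrite ≡ᵇ-≢ (m+1+n≢m o₁ {d}) | ≡ᵇ-≢ (outside-head out) | +-suc o₁ d =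
  trans (alternating-first (suc (suc L)) (suc o₁) (suc o₂) b d d<b (outside-tail out))
        (cong (_∷ []) (two-steps L d))

alternating-second : ∀ L o₁ o₂ b d → d < b → Outside o₁ b (o₂ + d) →
  labelsIn L (o₂ + d) (alternating o₁ o₂ b) ≡ L + suc (suc (d + d)) ∷ []
alternating-second L o₁ o₂ (suc b) zero _ out
  rewrite +-identityʳ o₂ | ≡ᵇ-≢ (outside-head out) | ≡ᵇ-refl o₂ =
  cong₂ _∷_ (+-comm 2 L) (alternating-absent (suc (suc L)) o₂ (suc o₁) (suc o₂) b (outside-tail out) (inj₁ ≤-refl))
alternating-second L o₁ o₂ (suc b) (suc d) (s≤s d<b) out
  rewrite ≡ᵇ-≢ (outside-head out) | ≡ᵇ-≢ (m+1+n≢m o₂ {d}) | +-suc o₂ d =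
  trans (alternating-second (suc (suc L)) (suc o₁) (suc o₂) b d d<b (outside-tail out))
        (cong (_∷ []) (two-steps′ L d))

alternating-diagonal : ∀ L o b d → d < b →
  labelsIn L (o + d) (alternating o o b) ≡ L + suc (d + d) ∷ L + suc (suc (d + d)) ∷ []
alternating-diagonal L o (suc b) zero _ rewrite +-identityʳ o | ≡ᵇ-refl o =
  cong₂ _∷_ (+-comm 1 L) (cong₂ _∷_ (+-comm 2 L)
    (alternating-absent (suc (suc L)) o (suc o) (suc o) b (inj₁ ≤-refl) (inj₁ ≤-refl)))
alternating-diagonal L o (suc b) (suc d) (s≤s d<b) rewrite ≡ᵇ-≢ (m+1+n≢m o {d}) | +-suc o d =
  trans (alternating-diagonal (suc (suc L)) (suc o) b d d<b) (cong₂ (λ x y → x ∷ y ∷ []) (two-steps L d) (two-steps′ L d))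

-- Layers of 4-blocks

quadruples : ℕ → ℕ → ℕ → List ℕ
quadruples o₁ o₂ zero    = []
quadruples o₁ o₂ (suc b) = o₁ ∷ o₂ ∷ o₂ ∷ o₁ ∷ quadruples (suc o₁) (suc o₂) b

length-quadruples : ∀ o₁ o₂ b → length (quadruples o₁ o₂ b) ≡ 4 * b
length-quadruples o₁ o₂ zero    = refl
length-quadruples o₁ o₂ (suc b) = trans (cong (_+_ 4) (length-quadruples (suc o₁) (suc o₂) b)) (sym (*-suc 4 b))

quadruples-within : ∀ o₁ o₂ b → All (Within₂ o₁ o₂ b) (quadruples o₁ o₂ b)
quadruples-within o₁ o₂ zero    = []
quadruples-within o₁ o₂ (suc b) =
  inj₁ (within-head o₁ b) ∷ inj₂ (within-head o₂ b) ∷ inj₂ (within-head o₂ b) ∷ inj₁ (within-head o₁ b)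
  ∷ All.map (Sum.map within-tail within-tail) (quadruples-within (suc o₁) (suc o₂) b)

private
  block-sums : ∀ L → suc L + (suc (suc (suc (suc L))) + 0) ≡ suc (suc L) + (suc (suc (suc L)) + 0)
  block-sums = solve-∀

block-balanced : ∀ L x y → x ≢ y → Balanced L x (x ∷ y ∷ y ∷ x ∷ []) (y ∷ x ∷ x ∷ y ∷ []) 4
block-balanced L x y x≢y = Balanced-chain (⊕ suc L ∷ ⊖ (2 + L) ∷ ⊖ (3 + L) ∷ ⊕ (4 + L) ∷ [])
  labels⁺ labels⁻ (n<1+n _ ∷ n<1+n _ ∷ n<1+n _ ∷ [-]) (block-sums L)
  where
    labels⁺ : labelsIn L x (x ∷ y ∷ y ∷ x ∷ []) ≡ suc L ∷ 4 + L ∷ []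
    labels⁺ rewrite ≡ᵇ-refl x | ≡ᵇ-≢ x≢y = refl
    labels⁻ : labelsIn L x (y ∷ x ∷ x ∷ y ∷ []) ≡ 2 + L ∷ 3 + L ∷ []
    labels⁻ rewrite ≡ᵇ-refl x | ≡ᵇ-≢ x≢y = refl

quadruples-absent : ∀ L ρ o₁ o₂ b → Outside o₁ b ρ → Outside o₂ b ρ →
  Balanced L ρ (quadruples o₁ o₂ b) (quadruples o₂ o₁ b) 0
quadruples-absent L ρ o₁ o₂ b out₁ out₂ = Balanced-absent
  (outside₂⇒absent out₁ out₂ (quadruples-within o₁ o₂ b)) (outside₂⇒absent out₂ out₁ (quadruples-within o₂ o₁ b))

within-behead : ∀ {o b x} → x ≢ o → Within o (suc b) x → Within (suc o) b x
within-behead {o} {b} {x} x≢o (o≤x , x<) = ≤∧≢⇒< o≤x (x≢o ∘ sym) , subst (x <_) (+-suc o b) x<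

quadruples-balanced : ∀ L ρ o₁ o₂ b → o₁ + b ≤ o₂ → Within₂ o₁ o₂ b ρ →
  Balanced L ρ (quadruples o₁ o₂ b) (quadruples o₂ o₁ b) 4
quadruples-balanced L ρ o₁ o₂ zero _ (inj₁ (o≤ρ , ρ<o)) = ⊥-elim (<⇒≱ (subst (ρ <_) (+-identityʳ o₁) ρ<o) o≤ρ)
quadruples-balanced L ρ o₁ o₂ zero _ (inj₂ (o≤ρ , ρ<o)) = ⊥-elim (<⇒≱ (subst (ρ <_) (+-identityʳ o₂) ρ<o) o≤ρ)
quadruples-balanced L ρ o₁ o₂ (suc b) o₁+b<o₂ ρ∈ with ρ ≟ o₁ | ρ ≟ o₂
... | yes refl | _ = Balanced-++ refl (block-balanced L o₁ o₂ (<⇒≢ o₁<o₂))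
  (quadruples-absent (L + 4) o₁ (suc o₁) (suc o₂) b (inj₁ ≤-refl) (inj₁ (m<n⇒m<1+n o₁<o₂)))
  where o₁<o₂ = <-≤-trans (m<m+n o₁ z<s) o₁+b<o₂
... | no _ | yes refl = Balanced-++ refl (Balanced-swap (block-balanced L o₂ o₁ (>⇒≢ o₁<o₂)))
  (quadruples-absent (L + 4) o₂ (suc o₁) (suc o₂) b (inj₂ (subst (_≤ o₂) (+-suc o₁ b) o₁+b<o₂)) (inj₁ ≤-refl))
  where o₁<o₂ = <-≤-trans (m<m+n o₁ z<s) o₁+b<o₂
... | no ρ≢o₁ | no ρ≢o₂ = Balanced-++ refl
  (Balanced-absent (ρ≢o₁ ∷ ρ≢o₂ ∷ ρ≢o₂ ∷ ρ≢o₁ ∷ []) (ρ≢o₂ ∷ ρ≢o₁ ∷ ρ≢o₁ ∷ ρ≢o₂ ∷ []))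
  (quadruples-balanced (L + 4) ρ (suc o₁) (suc o₂) b (m≤n⇒m≤1+n (subst (_≤ o₂) (+-suc o₁ b) o₁+b<o₂))
                       (Sum.map (within-behead ρ≢o₁) (within-behead ρ≢o₂) ρ∈))

layers⁺ layers⁻ : ℕ → ℕ → List ℕ
layers⁺ k zero    = []
layers⁺ k (suc q) = quadruples 0 k k ++ layers⁺ k q
layers⁻ k zero    = []
layers⁻ k (suc q) = quadruples k 0 k ++ layers⁻ k q

length-layers⁺ : ∀ k q → length (layers⁺ k q) ≡ q * (4 * k)
length-layers⁺ k zero    = refl
length-layers⁺ k (suc q) = trans (length-++ (quadruples 0 k k)) (cong₂ _+_ (length-quadruples 0 k k) (length-layers⁺ k q))

length-layers⁻ : ∀ k q → length (layers⁻ k q) ≡ q * (4 * k)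
length-layers⁻ k zero    = refl
length-layers⁻ k (suc q) = trans (length-++ (quadruples k 0 k)) (cong₂ _+_ (length-quadruples k 0 k) (length-layers⁻ k q))

layers⁺-within : ∀ k q → All (_< k + k) (layers⁺ k q)
layers⁺-within k zero    = []
layers⁺-within k (suc q) =
  All.++⁺ (All.map (within₂-bound (m≤n+m k k) ≤-refl) (quadruples-within 0 k k)) (layers⁺-within k q)

layers⁻-within : ∀ k q → All (_< k + k) (layers⁻ k q)
layers⁻-within k zero    = []
layers⁻-within k (suc q) =
  All.++⁺ (All.map (within₂-bound ≤-refl (m≤n+m k k)) (quadruples-within k 0 k)) (layers⁻-within k q)

layers-balanced : ∀ L ρ k q → ρ < k + k → Balanced L ρ (layers⁺ k q) (layers⁻ k q) (q * 4)
layers-balanced L ρ k zero    _ = Balanced-absent [] []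
layers-balanced L ρ k (suc q) ρ<2k = Balanced-++ (trans (length-quadruples 0 k k) (sym (length-quadruples k 0 k)))
  (quadruples-balanced L ρ 0 k k ≤-refl half) (layers-balanced _ ρ k q ρ<2k)
  where
    half : Within₂ 0 k k ρ
    half with ρ <? k
    ... | yes ρ<k = inj₁ (z≤n , ρ<k)
    ... | no  ρ≮k = inj₂ (≮⇒≥ ρ≮k , ρ<2k)

-- Cores of degree 3, 5 and 6

<-by-gap : ∀ {a b} c → suc a + c ≡ b → a < b
<-by-gap {a} c refl = m≤m+n (suc a) c

data HalfRow : ℕ → ℕ → Set where
  lower : ∀ e i → HalfRow (suc (e + i)) i
  upper : ∀ e i → HalfRow (suc (e + i)) (suc (e + i) + i)

halfRow : ∀ k {ρ} → ρ < k + k → HalfRow k ρ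
halfRow k {ρ} ρ<2k with ρ <? k
... | yes ρ<k with e , refl ← m≤n⇒∃[o]m+o≡n ρ<k =
  subst (λ K → HalfRow K ρ) (cong suc (+-comm e ρ)) (lower e ρ)
... | no ρ≮k with i , refl ← m≤n⇒∃[o]m+o≡n (≮⇒≥ ρ≮k)
             with e , refl ← m≤n⇒∃[o]m+o≡n (+-cancelˡ-< k i k ρ<2k) =
  subst (λ K → HalfRow K (K + i)) (cong suc (+-comm e i)) (upper e i)

core3⁺ core3⁻ : ℕ → List ℕ
core3⁺ k = ascending 0 k ++ ascending 0 k ++ ascending k k
core3⁻ k = descending k k ++ alternating k 0 k

-- Labels are computed for an abstract K; the balance lemmas then take K = suc (e + i), which
-- makes i < K visible to the ring solver.
core3⁺-lower : ∀ K i → i < K → labelsIn 0 i (core3⁺ K) ≡ suc i ∷ K + suc i ∷ []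
core3⁺-lower K i i<K
  rewrite labelsIn-++³ 0 i (ascending 0 K) (ascending 0 K) (ascending K K) | length-ascending 0 K
        | ascending-hit 0 0 K i i<K | ascending-hit K 0 K i i<K
        | ascending-absent (K + K) i K K (inj₁ i<K) = refl

core3⁻-lower : ∀ K i → i < K → labelsIn 0 i (core3⁻ K) ≡ K + suc (suc (i + i)) ∷ []
core3⁻-lower K i i<K
  rewrite labelsIn-++ 0 i (descending K K) (alternating K 0 K) | length-descending K K
        | descending-absent 0 i K K (inj₁ i<K) | alternating-second K K 0 K i i<K (inj₁ i<K) = refl

core3⁺-upper : ∀ K i → i < K → labelsIn 0 (K + i) (core3⁺ K) ≡ K + K + suc i ∷ []
core3⁺-upper K i i<K
  rewrite labelsIn-++³ 0 (K + i) (ascending 0 K) (ascending 0 K) (ascending K K) | length-ascending 0 K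
        | ascending-absent 0 (K + i) 0 K (inj₂ (m≤m+n K i)) | ascending-absent K (K + i) 0 K (inj₂ (m≤m+n K i))
        | ascending-hit (K + K) K K i i<K = refl

core3⁻-upper : ∀ K e i → suc (e + i) ≡ K → labelsIn 0 (K + i) (core3⁻ K) ≡ suc e ∷ K + suc (i + i) ∷ []
core3⁻-upper K e i K≡
  rewrite labelsIn-++ 0 (K + i) (descending K K) (alternating K 0 K) | length-descending K K
        | descending-hit 0 K K i e K≡
        | alternating-first K K 0 K i (subst (i <_) K≡ (s≤s (m≤n+m i e))) (inj₂ (m≤m+n K i)) = refl

core3-lower : ∀ e i → let K = suc (e + i) in Balanced 0 i (core3⁺ K) (core3⁻ K) 3
core3-lower e i = Balanced-chain (⊕ suc i ∷ ⊕ (K + suc i) ∷ ⊖ (K + suc (suc (i + i))) ∷ [])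
  (core3⁺-lower K i i<K) (core3⁻-lower K i i<K)
  (<-by-gap (e + i) (gap₁ e i) ∷ <-by-gap i (gap₂ e i) ∷ [-]) (sums e i)
  where
    K = suc (e + i)
    i<K : i < K
    i<K = s≤s (m≤n+m i e)
    gap₁ : ∀ e i → let K = suc (e + i) in suc (suc i) + (e + i) ≡ K + suc i
    gap₁ = solve-∀
    gap₂ : ∀ e i → let K = suc (e + i) in suc (K + suc i) + i ≡ K + suc (suc (i + i))
    gap₂ = solve-∀
    sums : ∀ e i → let K = suc (e + i) in suc i + (K + suc i + 0) ≡ K + suc (suc (i + i)) + 0
    sums = solve-∀

core3-upper : ∀ e i → let K = suc (e + i) in Balanced 0 (K + i) (core3⁺ K) (core3⁻ K) 3
core3-upper e i = Balanced-chain (⊖ suc e ∷ ⊖ (K + suc (i + i)) ∷ ⊕ (K + K + suc i) ∷ [])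
  (core3⁺-upper K i i<K) (core3⁻-upper K e i refl)
  (<-by-gap (i + i + i) (gap₁ e i) ∷ <-by-gap e (gap₂ e i) ∷ [-]) (sums e i)
  where
    K = suc (e + i)
    i<K : i < K
    i<K = s≤s (m≤n+m i e)
    gap₁ : ∀ e i → let K = suc (e + i) in suc (suc e) + (i + i + i) ≡ K + suc (i + i)
    gap₁ = solve-∀
    gap₂ : ∀ e i → let K = suc (e + i) in suc (K + suc (i + i)) + e ≡ K + K + suc i
    gap₂ = solve-∀
    sums : ∀ e i → let K = suc (e + i) in K + K + suc i + 0 ≡ suc e + (K + suc (i + i) + 0)
    sums = solve-∀

core3-balanced : ∀ K ρ → ρ < K + K → Balanced 0 ρ (core3⁺ K) (core3⁻ K) 3
core3-balanced K ρ ρ<2K with halfRow K ρ<2K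
... | lower e i = core3-lower e i
... | upper e i = core3-upper e i

x+[2+m]<y+K+[1+m] : ∀ x y m {K} → 2 ≤ K → x ≡ y → x + suc (suc m) < y + K + suc m
x+[2+m]<y+K+[1+m] x _ m {K} 2≤K refl =
  subst (x + suc (suc m) <_) (sym (+-assoc x K (suc m))) (+-monoʳ-< x (+-monoˡ-≤ (suc m) 2≤K))

core5⁺ core5⁻ : ℕ → List ℕ
core5⁺ k = ascending 0 k ++ ascending 0 k ++ rotated k k ++ alternating 0 k k
core5⁻ k = ascending k k ++ ascending k k ++ alternating 0 0 k ++ rotated k k

core5⁺-lower : ∀ K i → i < K → labelsIn 0 i (core5⁺ K) ≡ suc i ∷ K + suc i ∷ K + K + K + suc (i + i) ∷ []
core5⁺-lower K i i<K
  rewrite labelsIn-++⁴ 0 i (ascending 0 K) (ascending 0 K) (rotated K K) (alternating 0 K K)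
        | length-ascending 0 K | length-rotated K K
        | ascending-hit 0 0 K i i<K | ascending-hit K 0 K i i<K | rotated-absent (K + K) i K K (inj₁ i<K)
        | alternating-first (K + K + K) 0 K K i i<K (inj₁ i<K) = refl

core5⁻-lower : ∀ K i → i < K → labelsIn 0 i (core5⁻ K) ≡ K + K + suc (i + i) ∷ K + K + suc (suc (i + i)) ∷ []
core5⁻-lower K i i<K
  rewrite labelsIn-++⁴ 0 i (ascending K K) (ascending K K) (alternating 0 0 K) (rotated K K)
        | length-ascending K K | length-alternating 0 0 K
        | ascending-absent 0 i K K (inj₁ i<K) | ascending-absent K i K K (inj₁ i<K)
        | alternating-diagonal (K + K) 0 K i i<K | rotated-absent (K + K + (K + K)) i K K (inj₁ i<K) = refl

core5⁺-upper : ∀ K i → suc i < K →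
  labelsIn 0 (K + i) (core5⁺ K) ≡ K + K + suc (suc i) ∷ K + K + K + suc (suc (i + i)) ∷ []
core5⁺-upper K i i+1<K
  rewrite labelsIn-++⁴ 0 (K + i) (ascending 0 K) (ascending 0 K) (rotated K K) (alternating 0 K K)
        | length-ascending 0 K | length-rotated K K
        | ascending-absent 0 (K + i) 0 K (inj₂ (m≤m+n K i)) | ascending-absent K (K + i) 0 K (inj₂ (m≤m+n K i))
        | rotated-mid (K + K) K K i i+1<K
        | alternating-second (K + K + K) 0 K K i (<-trans (n<1+n i) i+1<K) (inj₂ (m≤m+n K i)) = refl

core5⁻-upper : ∀ K i → suc i < K →
  labelsIn 0 (K + i) (core5⁻ K) ≡ suc i ∷ K + suc i ∷ K + K + (K + K) + suc (suc i) ∷ []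
core5⁻-upper K i i+1<K
  rewrite labelsIn-++⁴ 0 (K + i) (ascending K K) (ascending K K) (alternating 0 0 K) (rotated K K)
        | length-ascending K K | length-alternating 0 0 K
        | ascending-hit 0 K K i (<-trans (n<1+n i) i+1<K) | ascending-hit K K K i (<-trans (n<1+n i) i+1<K)
        | alternating-absent (K + K) (K + i) 0 0 K (inj₂ (m≤m+n K i)) (inj₂ (m≤m+n K i))
        | rotated-mid (K + K + (K + K)) K K i i+1<K = refl

core5⁺-last : ∀ K i → suc i ≡ K →
  labelsIn 0 (K + i) (core5⁺ K) ≡ K + K + 1 ∷ K + K + K + suc (suc (i + i)) ∷ []
core5⁺-last K i i+1≡K
  rewrite labelsIn-++⁴ 0 (K + i) (ascending 0 K) (ascending 0 K) (rotated K K) (alternating 0 K K)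
        | length-ascending 0 K | length-rotated K K
        | ascending-absent 0 (K + i) 0 K (inj₂ (m≤m+n K i)) | ascending-absent K (K + i) 0 K (inj₂ (m≤m+n K i))
        | rotated-last (K + K) K K i i+1≡K
        | alternating-second (K + K + K) 0 K K i (≤-reflexive i+1≡K) (inj₂ (m≤m+n K i)) = refl

core5⁻-last : ∀ K i → suc i ≡ K →
  labelsIn 0 (K + i) (core5⁻ K) ≡ suc i ∷ K + suc i ∷ K + K + (K + K) + 1 ∷ []
core5⁻-last K i i+1≡K
  rewrite labelsIn-++⁴ 0 (K + i) (ascending K K) (ascending K K) (alternating 0 0 K) (rotated K K)
        | length-ascending K K | length-alternating 0 0 K
        | ascending-hit 0 K K i (≤-reflexive i+1≡K) | ascending-hit K K K i (≤-reflexive i+1≡K)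
        | alternating-absent (K + K) (K + i) 0 0 K (inj₂ (m≤m+n K i)) (inj₂ (m≤m+n K i))
        | rotated-last (K + K + (K + K)) K K i i+1≡K = refl

core5-lower : ∀ e i → let K = suc (e + i) in 2 ≤ K → Balanced 0 i (core5⁺ K) (core5⁻ K) 5
core5-lower e i 2≤K = Balanced-chain
  (⊕ suc i ∷ ⊕ (K + suc i) ∷ ⊖ (K + K + suc (i + i)) ∷ ⊖ (K + K + suc (suc (i + i)))
     ∷ ⊕ (K + K + K + suc (i + i)) ∷ [])
  (core5⁺-lower K i i<K) (core5⁻-lower K i i<K)
  (<-by-gap (e + i) (gap₁ e i) ∷ <-by-gap (e + i + i) (gap₂ e i) ∷ +-monoʳ-< (K + K) (n<1+n (suc (i + i)))
    ∷ x+[2+m]<y+K+[1+m] (K + K) (K + K) (i + i) 2≤K refl ∷ [-])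
  (sums K i)
  where
    K = suc (e + i)
    i<K : i < K
    i<K = s≤s (m≤n+m i e)
    gap₁ : ∀ e i → let K = suc (e + i) in suc (suc i) + (e + i) ≡ K + suc i
    gap₁ = solve-∀
    gap₂ : ∀ e i → let K = suc (e + i) in suc (K + suc i) + (e + i + i) ≡ K + K + suc (i + i)
    gap₂ = solve-∀
    sums : ∀ K i → suc i + (K + suc i + (K + K + K + suc (i + i) + 0))
                 ≡ K + K + suc (i + i) + (K + K + suc (suc (i + i)) + 0)
    sums = solve-∀

core5-upper : ∀ e i → let K = suc (suc e + i) in Balanced 0 (K + i) (core5⁺ K) (core5⁻ K) 5
core5-upper e i = Balanced-chain
  (⊖ suc i ∷ ⊖ (K + suc i) ∷ ⊕ (K + K + suc (suc i)) ∷ ⊕ (K + K + K + suc (suc (i + i)))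
     ∷ ⊖ (K + K + (K + K) + suc (suc i)) ∷ [])
  (core5⁺-upper K i i+1<K) (core5⁻-upper K i i+1<K)
  (<-by-gap (suc e + i) (gap₁ e i) ∷ <-by-gap K (gap₂ e i) ∷ <-by-gap (suc e + i + i) (gap₃ e i)
    ∷ <-by-gap (suc e) (gap₄ e i) ∷ [-])
  (sums K i)
  where
    K = suc (suc e + i)
    i+1<K : suc i < K
    i+1<K = s≤s (s≤s (m≤n+m i e))
    gap₁ : ∀ e i → let K = suc (suc e + i) in suc (suc i) + (suc e + i) ≡ K + suc i
    gap₁ = solve-∀
    gap₂ : ∀ e i → let K = suc (suc e + i) in suc (K + suc i) + K ≡ K + K + suc (suc i)
    gap₂ = solve-∀
    gap₃ : ∀ e i → let K = suc (suc e + i) in suc (K + K + suc (suc i)) + (suc e + i + i) ≡ K + K + K + suc (suc (i + i))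
    gap₃ = solve-∀
    gap₄ : ∀ e i → let K = suc (suc e + i) in
           suc (K + K + K + suc (suc (i + i))) + suc e ≡ K + K + (K + K) + suc (suc i)
    gap₄ = solve-∀
    sums : ∀ K i → K + K + suc (suc i) + (K + K + K + suc (suc (i + i)) + 0)
                 ≡ suc i + (K + suc i + (K + K + (K + K) + suc (suc i) + 0))
    sums = solve-∀

core5-last : ∀ j → let K = suc (suc j) in Balanced 0 (K + suc j) (core5⁺ K) (core5⁻ K) 5
core5-last j = Balanced-chain
  (⊖ suc i ∷ ⊖ (K + suc i) ∷ ⊕ (K + K + 1) ∷ ⊖ (K + K + (K + K) + 1) ∷ ⊕ (K + K + K + suc (suc (i + i))) ∷ [])
  (core5⁺-last K i refl) (core5⁻-last K i refl)
  (<-by-gap i (gap₁ j) ∷ <-by-gap 0 (gap₂ j) ∷ <-by-gap (i + K) (gap₃ j) ∷ <-by-gap j (gap₄ j) ∷ [-])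
  (sums K i)
  where
    i = suc j
    K = suc (suc j)
    gap₁ : ∀ j → let i = suc j; K = suc i in suc (suc i) + i ≡ K + suc i
    gap₁ = solve-∀
    gap₂ : ∀ j → let i = suc j; K = suc i in suc (K + suc i) + 0 ≡ K + K + 1
    gap₂ = solve-∀
    gap₃ : ∀ j → let i = suc j; K = suc i in suc (K + K + 1) + (i + K) ≡ K + K + (K + K) + 1
    gap₃ = solve-∀
    gap₄ : ∀ j → let i = suc j; K = suc i in suc (K + K + (K + K) + 1) + j ≡ K + K + K + suc (suc (i + i))
    gap₄ = solve-∀
    sums : ∀ K i → K + K + 1 + (K + K + K + suc (suc (i + i)) + 0)
                 ≡ suc i + (K + suc i + (K + K + (K + K) + 1 + 0))
    sums = solve-∀

core5-balanced : ∀ K ρ → 2 ≤ K → ρ < K + K → Balanced 0 ρ (core5⁺ K) (core5⁻ K) 5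
core5-balanced K ρ 2≤K ρ<2K with halfRow K ρ<2K
... | lower e i          = core5-lower e i 2≤K
... | upper (suc e) i    = core5-upper e i
... | upper zero (suc j) = core5-last j
... | upper zero zero    with s≤s () ← 2≤K

core6⁺ core6⁻ : ℕ → List ℕ
core6⁺ k = ascending 0 k ++ alternating 0 k k ++ ascending k k ++ alternating k 0 k
core6⁻ k = alternating k 0 k ++ ascending 0 k ++ alternating 0 k k ++ ascending k k

core6⁺-lower : ∀ K i → i < K →
  labelsIn 0 i (core6⁺ K) ≡ suc i ∷ K + suc (i + i) ∷ K + (K + K) + K + suc (suc (i + i)) ∷ []
core6⁺-lower K i i<K
  rewrite labelsIn-++⁴ 0 i (ascending 0 K) (alternating 0 K K) (ascending K K) (alternating K 0 K)
        | length-ascending 0 K | length-alternating 0 K K | length-ascending K K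
        | ascending-hit 0 0 K i i<K | alternating-first K 0 K K i i<K (inj₁ i<K)
        | ascending-absent (K + (K + K)) i K K (inj₁ i<K)
        | alternating-second (K + (K + K) + K) K 0 K i i<K (inj₁ i<K) = refl

core6⁻-lower : ∀ K i → i < K →
  labelsIn 0 i (core6⁻ K) ≡ suc (suc (i + i)) ∷ K + K + suc i ∷ K + K + K + suc (i + i) ∷ []
core6⁻-lower K i i<K
  rewrite labelsIn-++⁴ 0 i (alternating K 0 K) (ascending 0 K) (alternating 0 K K) (ascending K K)
        | length-alternating K 0 K | length-ascending 0 K | length-alternating 0 K K
        | alternating-second 0 K 0 K i i<K (inj₁ i<K) | ascending-hit (K + K) 0 K i i<K
        | alternating-first (K + K + K) 0 K K i i<K (inj₁ i<K)
        | ascending-absent (K + K + K + (K + K)) i K K (inj₁ i<K) = refl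

core6⁺-upper : ∀ K i → i < K →
  labelsIn 0 (K + i) (core6⁺ K) ≡ K + suc (suc (i + i)) ∷ K + (K + K) + suc i ∷ K + (K + K) + K + suc (i + i) ∷ []
core6⁺-upper K i i<K
  rewrite labelsIn-++⁴ 0 (K + i) (ascending 0 K) (alternating 0 K K) (ascending K K) (alternating K 0 K)
        | length-ascending 0 K | length-alternating 0 K K | length-ascending K K
        | ascending-absent 0 (K + i) 0 K (inj₂ (m≤m+n K i))
        | alternating-second K 0 K K i i<K (inj₂ (m≤m+n K i))
        | ascending-hit (K + (K + K)) K K i i<K
        | alternating-first (K + (K + K) + K) K 0 K i i<K (inj₂ (m≤m+n K i)) = refl

core6⁻-upper : ∀ K i → i < K →
  labelsIn 0 (K + i) (core6⁻ K) ≡ suc (i + i) ∷ K + K + K + suc (suc (i + i)) ∷ K + K + K + (K + K) + suc i ∷ []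
core6⁻-upper K i i<K
  rewrite labelsIn-++⁴ 0 (K + i) (alternating K 0 K) (ascending 0 K) (alternating 0 K K) (ascending K K)
        | length-alternating K 0 K | length-ascending 0 K | length-alternating 0 K K
        | alternating-first 0 K 0 K i i<K (inj₂ (m≤m+n K i))
        | ascending-absent (K + K) (K + i) 0 K (inj₂ (m≤m+n K i))
        | alternating-second (K + K + K) 0 K K i i<K (inj₂ (m≤m+n K i))
        | ascending-hit (K + K + K + (K + K)) K K i i<K = refl

core6-lower : ∀ e i → let K = suc (e + i) in 2 ≤ K → Balanced 0 i (core6⁺ K) (core6⁻ K) 6
core6-lower e i 2≤K = Balanced-chain
  (⊕ suc i ∷ ⊖ suc (suc (i + i)) ∷ ⊕ (K + suc (i + i)) ∷ ⊖ (K + K + suc i) ∷ ⊖ (K + K + K + suc (i + i))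
     ∷ ⊕ (K + (K + K) + K + suc (suc (i + i))) ∷ [])
  (core6⁺-lower K i i<K) (core6⁻-lower K i i<K)
  (<-by-gap i (gap₁ i) ∷ x+[2+m]<y+K+[1+m] 0 0 (i + i) 2≤K refl ∷ <-by-gap e (gap₃ e i) ∷ <-by-gap (e + i + i) (gap₄ e i)
    ∷ <-by-gap K (gap₅ K i) ∷ [-])
  (sums K i)
  where
    K = suc (e + i)
    i<K : i < K
    i<K = s≤s (m≤n+m i e)
    gap₁ : ∀ i → suc (suc i) + i ≡ suc (suc (i + i))
    gap₁ = solve-∀
    gap₃ : ∀ e i → let K = suc (e + i) in suc (K + suc (i + i)) + e ≡ K + K + suc i
    gap₃ = solve-∀
    gap₄ : ∀ e i → let K = suc (e + i) in suc (K + K + suc i) + (e + i + i) ≡ K + K + K + suc (i + i)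
    gap₄ = solve-∀
    gap₅ : ∀ K i → suc (K + K + K + suc (i + i)) + K ≡ K + (K + K) + K + suc (suc (i + i))
    gap₅ = solve-∀
    sums : ∀ K i → suc i + (K + suc (i + i) + (K + (K + K) + K + suc (suc (i + i)) + 0))
                 ≡ suc (suc (i + i)) + (K + K + suc i + (K + K + K + suc (i + i) + 0))
    sums = solve-∀

core6-upper : ∀ e i → let K = suc (e + i) in 2 ≤ K → Balanced 0 (K + i) (core6⁺ K) (core6⁻ K) 6
core6-upper e i 2≤K = Balanced-chain
  (⊖ suc (i + i) ∷ ⊕ (K + suc (suc (i + i))) ∷ ⊕ (K + (K + K) + suc i) ∷ ⊖ (K + K + K + suc (suc (i + i)))
     ∷ ⊕ (K + (K + K) + K + suc (i + i)) ∷ ⊖ (K + K + K + (K + K) + suc i) ∷ [])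
  (core6⁺-upper K i i<K) (core6⁻-upper K i i<K)
  (<-by-gap K (gap₁ K i) ∷ <-by-gap (e + e + i) (gap₂ e i) ∷ <-by-gap i (gap₃ K i)
    ∷ x+[2+m]<y+K+[1+m] (K + K + K) (K + (K + K)) (i + i) 2≤K (+-assoc K K K) ∷ <-by-gap e (gap₅ e i) ∷ [-])
  (sums K i)
  where
    K = suc (e + i)
    i<K : i < K
    i<K = s≤s (m≤n+m i e)
    gap₁ : ∀ K i → suc (suc (i + i)) + K ≡ K + suc (suc (i + i))
    gap₁ = solve-∀
    gap₂ : ∀ e i → let K = suc (e + i) in suc (K + suc (suc (i + i))) + (e + e + i) ≡ K + (K + K) + suc i
    gap₂ = solve-∀
    gap₃ : ∀ K i → suc (K + (K + K) + suc i) + i ≡ K + K + K + suc (suc (i + i))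
    gap₃ = solve-∀
    gap₅ : ∀ e i → let K = suc (e + i) in suc (K + (K + K) + K + suc (i + i)) + e ≡ K + K + K + (K + K) + suc i
    gap₅ = solve-∀
    sums : ∀ K i → K + suc (suc (i + i)) + (K + (K + K) + suc i + (K + (K + K) + K + suc (i + i) + 0))
                 ≡ suc (i + i) + (K + K + K + suc (suc (i + i)) + (K + K + K + (K + K) + suc i + 0))
    sums = solve-∀

core6-balanced : ∀ K ρ → 2 ≤ K → ρ < K + K → Balanced 0 ρ (core6⁺ K) (core6⁻ K) 6
core6-balanced K ρ 2≤K ρ<2K with halfRow K ρ<2K
... | lower e i = core6-lower e i 2≤K
... | upper e i = core6-upper e i 2≤K

private
  module _ {k : ℕ} where
    lowHalf : ∀ {xs} → All (Within 0 k) xs → All (_< k + k) xs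
    lowHalf = All.map (within-bound (m≤n+m k k))

    highHalf : ∀ {xs} → All (Within k k) xs → All (_< k + k) xs
    highHalf = All.map (within-bound ≤-refl)

    bothHalves : ∀ {o₁ o₂} {xs} → o₁ + k ≤ k + k → o₂ + k ≤ k + k → All (Within₂ o₁ o₂ k) xs → All (_< k + k) xs
    bothHalves h₁ h₂ = All.map (within₂-bound h₁ h₂)

core-width : ∀ k r (xs : List ℕ) → length xs ≡ r * k → length xs * 2 ≡ (k + k) * r
core-width k r xs len = trans (cong (_* 2) len) (r*k*2≡[k+k]*r k r)
  where r*k*2≡[k+k]*r : ∀ k r → r * k * 2 ≡ (k + k) * r
        r*k*2≡[k+k]*r = solve-∀

emptyDesign : ∀ k → Design (k + k) 0
emptyDesign k = record
  { pos = [] ; neg = [] ; sameLength = refl ; posInRange = [] ; negInRange = []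
  ; width = sym (*-zeroʳ (k + k)) ; balanced = λ _ _ → Balanced-absent [] [] }

core3-design : ∀ k → Design (k + k) 3
core3-design k = record
  { pos        = core3⁺ k
  ; neg        = core3⁻ k
  ; sameLength = trans length⁺ (sym length⁻)
  ; posInRange = All.++⁺ (lowHalf (ascending-within 0 k)) (All.++⁺ (lowHalf (ascending-within 0 k)) (highHalf (ascending-within k k)))
  ; negInRange = All.++⁺ (highHalf (descending-within k k)) (bothHalves ≤-refl (m≤n+m k k) (alternating-within k 0 k))
  ; width      = core-width k 3 (core3⁺ k) length⁺
  ; balanced   = core3-balanced k
  }
  where
    lengths : ∀ k → k + (k + k) ≡ 3 * k
    lengths = solve-∀
    length⁺ : length (core3⁺ k) ≡ 3 * k
    length⁺ rewrite length-++ (ascending 0 k) {ascending 0 k ++ ascending k k} | length-++ (ascending 0 k) {ascending k k}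
                  | length-ascending 0 k | length-ascending k k = lengths k
    length⁻ : length (core3⁻ k) ≡ 3 * k
    length⁻ rewrite length-++ (descending k k) {alternating k 0 k} | length-descending k k | length-alternating k 0 k = lengths k

core5-design : ∀ k → 2 ≤ k → Design (k + k) 5
core5-design k 2≤k = record
  { pos        = core5⁺ k
  ; neg        = core5⁻ k
  ; sameLength = trans length⁺ (sym length⁻)
  ; posInRange = All.++⁺ (lowHalf (ascending-within 0 k)) (All.++⁺ (lowHalf (ascending-within 0 k))
                   (All.++⁺ (highHalf (rotated-within k k)) (bothHalves (m≤n+m k k) ≤-refl (alternating-within 0 k k))))
  ; negInRange = All.++⁺ (highHalf (ascending-within k k)) (All.++⁺ (highHalf (ascending-within k k))
                   (All.++⁺ (bothHalves (m≤n+m k k) (m≤n+m k k) (alternating-within 0 0 k)) (highHalf (rotated-within k k))))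
  ; width      = core-width k 5 (core5⁺ k) length⁺
  ; balanced   = λ ρ → core5-balanced k ρ 2≤k
  }
  where
    lengths⁺ : ∀ k → k + (k + (k + (k + k))) ≡ 5 * k
    lengths⁺ = solve-∀
    lengths⁻ : ∀ k → k + (k + ((k + k) + k)) ≡ 5 * k
    lengths⁻ = solve-∀
    length⁺ : length (core5⁺ k) ≡ 5 * k
    length⁺ rewrite length-++ (ascending 0 k) {ascending 0 k ++ rotated k k ++ alternating 0 k k}
                  | length-++ (ascending 0 k) {rotated k k ++ alternating 0 k k} | length-++ (rotated k k) {alternating 0 k k}
                  | length-ascending 0 k | length-rotated k k | length-alternating 0 k k = lengths⁺ k
    length⁻ : length (core5⁻ k) ≡ 5 * k
    length⁻ rewrite length-++ (ascending k k) {ascending k k ++ alternating 0 0 k ++ rotated k k}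
                  | length-++ (ascending k k) {alternating 0 0 k ++ rotated k k} | length-++ (alternating 0 0 k) {rotated k k}
                  | length-ascending k k | length-rotated k k | length-alternating 0 0 k = lengths⁻ k

core6-design : ∀ k → 2 ≤ k → Design (k + k) 6
core6-design k 2≤k = record
  { pos        = core6⁺ k
  ; neg        = core6⁻ k
  ; sameLength = trans length⁺ (sym length⁻)
  ; posInRange = All.++⁺ (lowHalf (ascending-within 0 k)) (All.++⁺ (bothHalves (m≤n+m k k) ≤-refl (alternating-within 0 k k))
                   (All.++⁺ (highHalf (ascending-within k k)) (bothHalves ≤-refl (m≤n+m k k) (alternating-within k 0 k))))
  ; negInRange = All.++⁺ (bothHalves ≤-refl (m≤n+m k k) (alternating-within k 0 k)) (All.++⁺ (lowHalf (ascending-within 0 k))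
                   (All.++⁺ (bothHalves (m≤n+m k k) ≤-refl (alternating-within 0 k k)) (highHalf (ascending-within k k))))
  ; width      = core-width k 6 (core6⁺ k) length⁺
  ; balanced   = λ ρ → core6-balanced k ρ 2≤k
  }
  where
    lengths⁺ : ∀ k → k + ((k + k) + (k + (k + k))) ≡ 6 * k
    lengths⁺ = solve-∀
    lengths⁻ : ∀ k → (k + k) + (k + ((k + k) + k)) ≡ 6 * k
    lengths⁻ = solve-∀
    length⁺ : length (core6⁺ k) ≡ 6 * k
    length⁺ rewrite length-++ (ascending 0 k) {alternating 0 k k ++ ascending k k ++ alternating k 0 k}
                  | length-++ (alternating 0 k k) {ascending k k ++ alternating k 0 k} | length-++ (ascending k k) {alternating k 0 k}
                  | length-ascending 0 k | length-ascending k k | length-alternating 0 k k | length-alternating k 0 k = lengths⁺ k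
    length⁻ : length (core6⁻ k) ≡ 6 * k
    length⁻ rewrite length-++ (alternating k 0 k) {ascending 0 k ++ alternating 0 k k ++ ascending k k}
                  | length-++ (ascending 0 k) {alternating 0 k k ++ ascending k k} | length-++ (alternating 0 k k) {ascending k k}
                  | length-ascending 0 k | length-ascending k k | length-alternating 0 k k | length-alternating k 0 k = lengths⁻ k

withLayers : ∀ k {r} q → Design (k + k) r → Design (k + k) (r + q * 4)
withLayers k {r} q D = record
  { pos        = pos ++ layers⁺ k q
  ; neg        = neg ++ layers⁻ k q
  ; sameLength = trans (length-++ pos) (trans (cong₂ _+_ sameLength (trans (length-layers⁺ k q) (sym (length-layers⁻ k q))))
                                             (sym (length-++ neg)))
  ; posInRange = All.++⁺ posInRange (layers⁺-within k q)
  ; negInRange = All.++⁺ negInRange (layers⁻-within k q)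
  ; width      = begin
      length (pos ++ layers⁺ k q) * 2           ≡⟨ cong (_* 2) (trans (length-++ pos) (cong (_+_ (length pos)) (length-layers⁺ k q))) ⟩
      (length pos + q * (4 * k)) * 2            ≡⟨ *-distribʳ-+ 2 (length pos) (q * (4 * k)) ⟩
      length pos * 2 + q * (4 * k) * 2          ≡⟨ cong₂ _+_ width (layer-width k q) ⟩
      (k + k) * r + (k + k) * (q * 4)           ≡⟨ *-distribˡ-+ (k + k) r (q * 4) ⟨
      (k + k) * (r + q * 4)                     ∎
  ; balanced   = λ ρ ρ<2k → Balanced-++ sameLength (balanced ρ ρ<2k) (layers-balanced _ ρ k q ρ<2k)
  }
  where
    open Design D
    open ≡-Reasoning
    layer-width : ∀ k q → q * (4 * k) * 2 ≡ (k + k) * (q * 4)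
    layer-width = solve-∀

design-by-residue : ∀ k s q → s < 4 → (2 ≤ k × 3 ≤ s + q * 4) ⊎ (s ≡ 0 ⊎ s ≡ 3) → Design (k + k) (s + q * 4)
design-by-residue k 0 q _ _ = withLayers k q (emptyDesign k)
design-by-residue k 3 q _ _ = withLayers k q (core3-design k)
design-by-residue k 1 (suc q) _ (inj₁ (2≤k , _)) = withLayers k q (core5-design k 2≤k)
design-by-residue k 2 (suc q) _ (inj₁ (2≤k , _)) = withLayers k q (core6-design k 2≤k)
design-by-residue k 1 zero _ (inj₁ (_ , s≤s ()))
design-by-residue k 2 zero _ (inj₁ (_ , s≤s (s≤s ())))
design-by-residue k 1 q _ (inj₂ (inj₁ ()))
design-by-residue k 1 q _ (inj₂ (inj₂ ()))
design-by-residue k 2 q _ (inj₂ (inj₁ ()))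
design-by-residue k 2 q _ (inj₂ (inj₂ ()))
design-by-residue k (suc (suc (suc (suc s)))) q (s≤s (s≤s (s≤s (s≤s ())))) _

design : ∀ k r → (2 ≤ k × 3 ≤ r) ⊎ (r % 4 ≡ 0 ⊎ r % 4 ≡ 3) → Design (k + k) r
design k r cond = subst (Design (k + k)) (sym r≡) (design-by-residue k (r % 4) (r / 4) (m%n<n r 4) cond′)
  where
    r≡ = m≡m%n+[m/n]*n r 4
    cond′ = Sum.map₁ (λ (2≤k , 3≤r) → 2≤k , subst (3 ≤_) r≡ 3≤r) cond

-- Lines with few entries

lineSum-unfilled : ∀ {k} (f : Fin k → Maybe ℤ) → filledCount f ≡ 0 → lineSum f ≡ ℤ.0ℤ
lineSum-unfilled {zero}  f _ = refl
lineSum-unfilled {suc k} f c with f Fin.zero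
... | nothing = lineSum-unfilled (f ∘ Fin.suc) c

filledCount-nonzero : ∀ {k} (f : Fin k → Maybe ℤ) {j x} → f j ≡ just x → filledCount f ≢ 0
filledCount-nonzero {suc k} f {Fin.zero}  fj c with f Fin.zero
filledCount-nonzero {suc k} f {Fin.zero}  () c | nothing
filledCount-nonzero {suc k} f {Fin.suc j} fj c with f Fin.zero
... | nothing = filledCount-nonzero (f ∘ Fin.suc) fj c

lineSum-single : ∀ {k} (f : Fin k → Maybe ℤ) {j x} → filledCount f ≡ 1 → f j ≡ just x → lineSum f ≡ x
lineSum-single {suc k} f {Fin.zero} c fj with f Fin.zero
lineSum-single {suc k} f {Fin.zero} c refl | just x =
  trans (cong (ℤ._+_ x) (lineSum-unfilled (f ∘ Fin.suc) (suc-injective c))) (ℤᵖ.+-identityʳ x)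
lineSum-single {suc k} f {Fin.suc j} c fj with f Fin.zero
... | just _  = ⊥-elim (filledCount-nonzero (f ∘ Fin.suc) fj (suc-injective c))
... | nothing = lineSum-single (f ∘ Fin.suc) c fj

single-entry : ∀ {k} (f : Fin k → Maybe ℤ) → filledCount f ≡ 1 → ∃ λ j → f j ≡ just (lineSum f)
single-entry {suc k} f c with f Fin.zero in f0
... | just x  = Fin.zero , trans f0 (cong just (sym (trans (cong (ℤ._+_ x) (lineSum-unfilled (f ∘ Fin.suc) (suc-injective c)))
                                                          (ℤᵖ.+-identityʳ x))))
... | nothing = let j , fj = single-entry (f ∘ Fin.suc) c in Fin.suc j , fj

private
  cancel : ∀ x y → x ≡ (x ℤ.+ y) ℤ.- y
  cancel = ℤ-Solver.solve-∀

  cancel′ : ∀ x y → y ≡ (x ℤ.+ y) ℤ.- x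
  cancel′ = ℤ-Solver.solve-∀

pair-partner : ∀ {k} (f : Fin k → Maybe ℤ) {j x} → filledCount f ≡ 2 → f j ≡ just x →
  ∃ λ j′ → f j′ ≡ just (lineSum f ℤ.- x)
pair-partner {suc k} f {j} {x} c fj with f Fin.zero in f0 | j
... | just y  | Fin.zero with refl ← trans (sym f0) fj =
  let j′ , fj′ = single-entry (f ∘ Fin.suc) (suc-injective c) in Fin.suc j′ , trans fj′ (cong just (cancel′ x _))
... | just y  | Fin.suc j₀ = Fin.zero , trans f0 (cong just (trans (cancel y x)
                               (cong (λ s → (y ℤ.+ s) ℤ.- x) (sym (lineSum-single (f ∘ Fin.suc) (suc-injective c) fj)))))
... | nothing | Fin.zero with () ← trans (sym f0) fj
... | nothing | Fin.suc j₀ = let j′ , fj′ = pair-partner (f ∘ Fin.suc) c fj in Fin.suc j′ , fj′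

entry-nonzero : ∀ {m n r s} (S : SMR m n r s) i j {x} → SMR.array S i j ≡ just x → x ≢ ℤ.0ℤ
entry-nonzero S i j e = proj₁ (SMR.entriesInX S i j _ e)

negation-partner : ∀ {k} (f : Fin k → Maybe ℤ) {j x} → filledCount f ≡ 2 → lineSum f ≡ ℤ.0ℤ → f j ≡ just x →
  ∃ λ j′ → f j′ ≡ just (ℤ.- x)
negation-partner f {x = x} c s fj =
  let j′ , fj′ = pair-partner f c fj
  in j′ , trans fj′ (cong just (trans (cong (ℤ._- x) s) (ℤᵖ.+-identityˡ (ℤ.- x))))

module _ {m n : ℕ} (S : SMR m n 1 2) where
  open SMR S

  no-single-entry-rows : 0 < m → ⊥
  no-single-entry-rows 0<m
    with j , e ← single-entry (λ j → array (fromℕ< 0<m) j) (rowFilled (fromℕ< 0<m)) =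
    entry-nonzero S (fromℕ< 0<m) j (trans e (cong just (rowSum (fromℕ< 0<m)))) refl

module _ {m n : ℕ} (S : SMR m n 2 2) where
  open SMR S

  no-two-entry-rows : 0 < m → ⊥
  no-two-entry-rows 0<m
    with i , j , e ← allAppear (+ 1) ((λ ()) , *-monoˡ-≤ 2 0<m)
    with i′ , e′ ← negation-partner (λ i → array i j) (colFilled j) (colSum j) e
    with j′ , e″ ← negation-partner (λ j → array i′ j) (rowFilled i′) (rowSum i′) e′
    with refl , refl ← appearOnce i j i′ j′ (+ 1) e e″
    with () ← trans (sym e) e′

three≤r : ∀ {m n r} → 0 < m → 0 < r → SMR m n r 2 → 3 ≤ r
three≤r {r = 1}                 0<m _ S = ⊥-elim (no-single-entry-rows S 0<m)
three≤r {r = 2}                 0<m _ S = ⊥-elim (no-two-entry-rows S 0<m)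
three≤r {r = suc (suc (suc r))} _   _ _ = s≤s (s≤s (s≤s z≤n))

-- Two rows

filledCount≤ : ∀ {k} (f : Fin k → Maybe ℤ) → filledCount f ≤ k
filledCount≤ {zero}  f = z≤n
filledCount≤ {suc k} f with f Fin.zero
... | just _  = s≤s (filledCount≤ (f ∘ Fin.suc))
... | nothing = m≤n⇒m≤1+n (filledCount≤ (f ∘ Fin.suc))

negation-unique : ∀ a b → a ℤ.+ b ≡ ℤ.0ℤ → b ≡ ℤ.- a
negation-unique a b a+b≡0 = trans (cancel′ a b) (trans (cong (ℤ._- a) a+b≡0) (ℤᵖ.+-identityˡ (ℤ.- a)))

two-entries : (f : Fin 2 → Maybe ℤ) → filledCount f ≡ 2 → lineSum f ≡ ℤ.0ℤ →
  ∃ λ a → f Fin.zero ≡ just a × f (Fin.suc Fin.zero) ≡ just (ℤ.- a)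
two-entries f c s with f Fin.zero
... | nothing = ⊥-elim (<-irrefl c (s≤s (filledCount≤ (f ∘ Fin.suc))))
... | just a with single-entry (f ∘ Fin.suc) (suc-injective c)
...   | Fin.zero , e = a , refl , trans e (cong just (negation-unique a _ s))

negPart : ℤ → ℕ
negPart (+ _)      = 0
negPart -[1+ t ]   = suc t

∣∣-via-negPart : ∀ x → + ∣ x ∣ ≡ x ℤ.+ (+ negPart x ℤ.+ + negPart x)
∣∣-via-negPart (+ t)      = sym (ℤᵖ.+-identityʳ (+ t))
∣∣-via-negPart -[1+ t ]   = sym (begin
  -[1+ t ] ℤ.+ (+ suc t ℤ.+ + suc t)   ≡⟨ ℤᵖ.+-assoc -[1+ t ] (+ suc t) (+ suc t) ⟨
  (-[1+ t ] ℤ.+ + suc t) ℤ.+ + suc t   ≡⟨ cong (ℤ._+ + suc t) (ℤᵖ.+-inverseˡ (+ suc t)) ⟩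
  ℤ.0ℤ ℤ.+ + suc t                     ≡⟨ ℤᵖ.+-identityˡ (+ suc t) ⟩
  + suc t                              ∎)
  where open ≡-Reasoning

private
  regroup : ∀ a l p q → (a ℤ.+ (p ℤ.+ p)) ℤ.+ (l ℤ.+ (q ℤ.+ q)) ≡ (a ℤ.+ l) ℤ.+ ((p ℤ.+ q) ℤ.+ (p ℤ.+ q))
  regroup = ℤ-Solver.solve-∀

sum-∣∣ : ∀ {n} (a : Fin n → ℤ) → let N = ∑ (λ j → negPart (a j)) in
  + ∑ (λ j → ∣ a j ∣) ≡ lineSum (λ j → just (a j)) ℤ.+ (+ N ℤ.+ + N)
sum-∣∣ {zero}  a = refl
sum-∣∣ {suc n} a = begin
  + (∣ a₀ ∣ + ∑ (λ j → ∣ a (Fin.suc j) ∣))         ≡⟨ ℤᵖ.pos-+ ∣ a₀ ∣ _ ⟩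
  + ∣ a₀ ∣ ℤ.+ + ∑ (λ j → ∣ a (Fin.suc j) ∣)       ≡⟨ cong₂ ℤ._+_ (∣∣-via-negPart a₀) (sum-∣∣ (a ∘ Fin.suc)) ⟩
  (a₀ ℤ.+ (+ n₀ ℤ.+ + n₀)) ℤ.+ (L ℤ.+ (+ N ℤ.+ + N))  ≡⟨ regroup a₀ L (+ n₀) (+ N) ⟩
  (a₀ ℤ.+ L) ℤ.+ ((+ n₀ ℤ.+ + N) ℤ.+ (+ n₀ ℤ.+ + N)) ≡⟨ cong (λ x → (a₀ ℤ.+ L) ℤ.+ (x ℤ.+ x)) (ℤᵖ.pos-+ n₀ N) ⟨
  (a₀ ℤ.+ L) ℤ.+ (+ (n₀ + N) ℤ.+ + (n₀ + N))         ∎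
  where
    open ≡-Reasoning
    a₀ = a Fin.zero
    n₀ = negPart a₀
    L  = lineSum (λ j → just (a (Fin.suc j)))
    N  = ∑ (λ j → negPart (a (Fin.suc j)))

sum-labels : ∀ n c → 2 * ∑ {n} (λ t → c + suc (toℕ t)) ≡ n * (c + c + suc n)
sum-labels zero    c = refl
sum-labels (suc n) c = begin
  2 * (c + 1 + ∑ {n} (λ t → c + suc (suc (toℕ t))))   ≡⟨ cong (λ s → 2 * (c + 1 + s)) (sum-cong-≗ {n} (λ t → +-suc c (suc (toℕ t)))) ⟩
  2 * (c + 1 + ∑ {n} (λ t → suc c + suc (toℕ t)))     ≡⟨ *-distribˡ-+ 2 (c + 1) _ ⟩
  2 * (c + 1) + 2 * ∑ {n} (λ t → suc c + suc (toℕ t)) ≡⟨ cong (_+_ (2 * (c + 1))) (sum-labels n (suc c)) ⟩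
  2 * (c + 1) + n * (suc c + suc c + suc n)           ≡⟨ step n c ⟩
  suc n * (c + c + suc (suc n))                       ∎
  where
    open ≡-Reasoning
    step : ∀ n c → 2 * (c + 1) + n * (suc c + suc c + suc n) ≡ suc n * (c + c + suc (suc n))
    step = solve-∀

4∤4t+2 : ∀ t → ¬ 4 ∣ t * 4 + 2
4∤4t+2 t 4∣ with s≤s (s≤s ()) ← ∣⇒≤ (∣m+n∣m⇒∣n 4∣ (n∣m*n t))

triangular-residue : ∀ n → 4 ∣ n * suc n → n % 4 ≡ 0 ⊎ n % 4 ≡ 3
triangular-residue n 4∣ with n % 4 | m≡m%n+[m/n]*n n 4 | m%n<n n 4
... | 0 | _  | _ = inj₁ refl
... | 3 | _  | _ = inj₂ refl
... | 1 | n≡ | _ =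
  ⊥-elim (4∤4t+2 (q * (3 + q * 4)) (subst (4 ∣_) (trans (cong (λ n → n * suc n) n≡) (expand q)) 4∣))
  where q = n / 4
        expand : ∀ q → (1 + q * 4) * suc (1 + q * 4) ≡ q * (3 + q * 4) * 4 + 2
        expand = solve-∀
... | 2 | n≡ | _ =
  ⊥-elim (4∤4t+2 (1 + q * (5 + q * 4)) (subst (4 ∣_) (trans (cong (λ n → n * suc n) n≡) (expand q)) 4∣))
  where q = n / 4
        expand : ∀ q → (2 + q * 4) * suc (2 + q * 4) ≡ (1 + q * (5 + q * 4)) * 4 + 2
        expand = solve-∀
... | suc (suc (suc (suc _))) | _ | s≤s (s≤s (s≤s (s≤s ())))

∣∣-suc : ∀ x → x ≢ ℤ.0ℤ → ∃ λ t → ∣ x ∣ ≡ suc t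
∣∣-suc (+ zero)  x≢0 = ⊥-elim (x≢0 refl)
∣∣-suc (+ suc t) _   = t , refl
∣∣-suc -[1+ t ]  _   = t , refl

∣∣-sign : ∀ x → + ∣ x ∣ ≡ x ⊎ + ∣ x ∣ ≡ ℤ.- x
∣∣-sign (+ t)    = inj₁ refl
∣∣-sign -[1+ t ] = inj₂ refl

module _ {n} (S : SMR 2 n n 2) where
  open SMR S

  private
    top bottom : Fin 2
    top    = Fin.zero
    bottom = Fin.suc Fin.zero

    column : ∀ j → ∃ λ a → array top j ≡ just a × array bottom j ≡ just (ℤ.- a)
    column j = two-entries (λ i → array i j) (colFilled j) (colSum j)

    a : Fin n → ℤ
    a j = proj₁ (column j)

    a-top : ∀ j → array top j ≡ just (a j)
    a-top j = proj₁ (proj₂ (column j))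

    a-bottom : ∀ j → array bottom j ≡ just (ℤ.- a j)
    a-bottom j = proj₂ (proj₂ (column j))

    magnitude : ∀ j → ∃ λ t → ∣ a j ∣ ≡ suc t
    magnitude j = ∣∣-suc (a j) (entry-nonzero S top j (a-top j))

    magnitude<n : ∀ j → proj₁ (magnitude j) < n
    magnitude<n j = *-cancelˡ-≤ 2 (subst (λ x → 2 * x ≤ 2 * n) (proj₂ (magnitude j))
                                         (proj₂ (entriesInX top j (a j) (a-top j))))

    σ : Fin n → Fin n
    σ j = fromℕ< (magnitude<n j)

    σ-magnitude : ∀ j → suc (toℕ (σ j)) ≡ ∣ a j ∣
    σ-magnitude j = trans (cong suc (Finᵖ.toℕ-fromℕ< (magnitude<n j))) (sym (proj₂ (magnitude j)))

    label-in-X : ∀ (t : Fin n) → InX (2 * n) (+ suc (toℕ t))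
    label-in-X t = (λ ()) , *-monoʳ-≤ 2 (Finᵖ.toℕ<n t)

    τ : Fin n → Fin n
    τ t = proj₁ (proj₂ (allAppear _ (label-in-X t)))

    σ∘τ : ∀ t → σ (τ t) ≡ t
    σ∘τ t with allAppear _ (label-in-X t)
    ... | Fin.zero , j , e = Finᵖ.toℕ-injective (suc-injective (trans (σ-magnitude j)
                               (cong ∣_∣ (Maybe.just-injective (trans (sym (a-top j)) e)))))
    ... | Fin.suc Fin.zero , j , e = Finᵖ.toℕ-injective (suc-injective (trans (σ-magnitude j)
                               (trans (sym (ℤᵖ.∣-i∣≡∣i∣ (a j))) (cong ∣_∣ (Maybe.just-injective (trans (sym (a-bottom j)) e))))))

    τ∘σ : ∀ j → τ (σ j) ≡ j
    τ∘σ j with allAppear _ (label-in-X (σ j)) | ∣∣-sign (a j)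
    ... | i′ , j′ , e | inj₁ ∣a∣≡a  = proj₂ (appearOnce i′ j′ top j _ e (trans (a-top j) (cong just (trans (sym ∣a∣≡a) σ-label))))
      where σ-label = cong +_ (sym (σ-magnitude j))
    ... | i′ , j′ , e | inj₂ ∣a∣≡-a = proj₂ (appearOnce i′ j′ bottom j _ e (trans (a-bottom j) (cong just (trans (sym ∣a∣≡-a) σ-label))))
      where σ-label = cong +_ (sym (σ-magnitude j))

    N : ℕ
    N = ∑ (λ j → negPart (a j))

    sum-magnitudes : ∑ (λ j → ∣ a j ∣) ≡ N + N
    sum-magnitudes = ℤᵖ.+-injective (begin
      + ∑ (λ j → ∣ a j ∣)                           ≡⟨ sum-∣∣ a ⟩
      lineSum (λ j → just (a j)) ℤ.+ (+ N ℤ.+ + N) ≡⟨ cong (ℤ._+ (+ N ℤ.+ + N)) (trans (lineSum-cong (sym ∘ a-top)) (rowSum top)) ⟩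
      ℤ.0ℤ ℤ.+ (+ N ℤ.+ + N)                       ≡⟨ ℤᵖ.+-identityˡ _ ⟩
      + N ℤ.+ + N                                  ≡⟨ ℤᵖ.pos-+ N N ⟨
      + (N + N)                                    ∎)
      where open ≡-Reasoning

    four∣ : 4 ∣ n * suc n
    four∣ = divides N (begin
      n * suc n                         ≡⟨ sum-labels n 0 ⟨
      2 * ∑ {n} (λ t → suc (toℕ t))     ≡⟨ cong (2 *_) (sum-permute (λ t → suc (toℕ t)) (permutation σ τ σ∘τ τ∘σ)) ⟩
      2 * ∑ {n} (λ j → suc (toℕ (σ j))) ≡⟨ cong (2 *_) (trans (sum-cong-≗ σ-magnitude) sum-magnitudes) ⟩
      2 * (N + N)                       ≡⟨ double N ⟩
      N * 4                             ∎)
      where open ≡-Reasoning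
            double : ∀ N → 2 * (N + N) ≡ N * 4
            double = solve-∀

  two-rows-residue : n % 4 ≡ 0 ⊎ n % 4 ≡ 3
  two-rows-residue = triangular-residue n four∣

SMR-from-design : ∀ {m n r} → Design m r → m * r ≡ 2 * n → SMR m n r 2
SMR-from-design {m} {n} {r} D mr≡2n = subst (λ n → SMR m n r 2) columns (design⇒SMR D)
  where columns = *-cancelʳ-≡ _ n 2 (trans (Design.width D) (trans mr≡2n (*-comm 2 n)))

necessary : ∀ m n r → 2 ∣ m → 0 < m → 0 < r → SMR m n r 2 →
  (m ≡ 2 × n ≡ r × (n % 4 ≡ 0 ⊎ n % 4 ≡ 3)) ⊎ (4 ≤ m × 3 ≤ r × m * r ≡ 2 * n)
necessary m n r (divides (suc zero) refl) _ _ S =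
  inj₁ (refl , n≡r , two-rows-residue (subst (λ r → SMR 2 n r 2) (sym n≡r) S))
  where n≡r = *-cancelʳ-≡ n r 2 (trans (sym (SMR.shape S)) (*-comm 2 r))
necessary m n r (divides (suc (suc k)) refl) 0<m 0<r S =
  inj₂ (s≤s (s≤s (s≤s (s≤s z≤n))) , three≤r 0<m 0<r S , trans (SMR.shape S) (*-comm n 2))

sufficient : ∀ m n r → 2 ∣ m →
  (m ≡ 2 × n ≡ r × (n % 4 ≡ 0 ⊎ n % 4 ≡ 3)) ⊎ (4 ≤ m × 3 ≤ r × m * r ≡ 2 * n) → SMR m n r 2
sufficient _ n _ _ (inj₁ (refl , refl , residue)) = SMR-from-design (design 1 n (inj₂ residue)) refl
sufficient m n r (divides k refl) (inj₂ (4≤m , 3≤r , mr≡2n)) =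
  SMR-from-design (subst (λ m → Design m r) k+k≡k*2 (design k r (inj₁ (2≤k , 3≤r)))) mr≡2n
  where 2≤k = *-cancelʳ-≤ 2 k 2 4≤m
        k+k≡k*2 = sym (trans (*-suc k 1) (cong (_+_ k) (*-identityʳ k)))

theorem21 : (m n r : ℕ) → 2 ∣ m → 0 < m → 0 < n → 0 < r →
    (SMR m n r 2 ⇔
      ((m ≡ 2 × n ≡ r × (n % 4 ≡ 0 ⊎ n % 4 ≡ 3))
        ⊎ (4 ≤ m × 3 ≤ r × m * r ≡ 2 * n)))
theorem21 m n r 2∣m 0<m _ 0<r = mk⇔ (necessary m n r 2∣m 0<m 0<r) (sufficient m n r 2∣m)
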